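{- Let $c\ge 1$ and $n\ge 1$ be integers and let $a\in\{1,\dots,c\}$ be a color. Then $$\left|\Pi_n^{eq}\wr C_c(1^a1^a)\right|=\sum_{i+2j\le n}\binom{n}{i,j}\sum_{p=j}^{n-i-j}\binom{n-i-j}{p}S(p,j)\,j!\,B(n-i-j-p)\,(c-1)^{n-i-j},$$ where the outer sum is over all pairs of nonnegative integers $(i,j)$ with $i+2j\le n$.
   Context: A set partition of $[n]=\{1,\dots,n\}$ is a collection of pairwise disjoint nonempty subsets (blocks) whose union is $[n]$. $\Pi_n\wr C_c$ denotes the set of colored set partitions of $[n]$ with $c$ colors: pairs consisting of a set partition of $[n]$ and an assignment of a color in $\{1,\dots,c\}$ to each element of $[n]$. A colored partition eq-contains the colored pattern $1^a1^a$ if some block contains two distinct elements both of color $a$; otherwise it eq-avoids it. $\Pi_n^{eq}\wr C_c(1^a1^a)$ is the set of elements of $\Pi_n\wr C_c$ that eq-avoid $1^a1^a$. $B(m)$ is the $m$-th Bell number ($B(0)=1$), $S(p,j)$ is the Stirling number of the second kind (with $S(0,0)=1$, $S(p,0)=0$ for $p>0$), and $\binom{n}{i,j}=\frac{n!}{i!\,j!\,(n-i-j)!}$. -}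

module Defs where

open import Data.Nat as ℕ using (ℕ; zero; suc; _+_; _*_; _∸_; _^_; _/_; _!; NonZero)
open import Data.Nat.Properties using (_!≢0; m*n≢0)
open import Data.Nat.Combinatorics using (_C_)
open import Data.Fin as F using (Fin; toℕ)
open import Data.Fin.Properties using (all?; any?; _≟_)
open import Data.Vec using (Vec; lookup)
open import Data.List using (List; map; applyUpTo; upTo)
open import Data.Nat.ListAction using (sum)
open import Data.Product using (Σ; ∃; _×_; _,_)
open import Data.Bool using (if_then_else_)
open import Relation.Binary.PropositionalEquality using (_≡_; _≢_)
open import Relation.Nullary using (¬_; Dec)
open import Relation.Nullary.Decidable using (True; ⌊_⌋; _×-dec_; ¬?)
open import Function.Bundles using (_↔_)

-- A set partition is encoded canonically by the vector v that sends every
-- element to the minimum element of its block.  Such a v is exactly a map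
-- with  v i ≤ i  and  v (v i) = v i  (blocks = fibres of v).

IsSetPartition : ∀ {n} → Vec (Fin n) n → Set
IsSetPartition {n} v =
  ∀ (i : Fin n) → (toℕ (lookup v i) ℕ.≤ toℕ i) × (lookup v (lookup v i) ≡ lookup v i)

isSetPartition? : ∀ {n} (v : Vec (Fin n) n) → Dec (IsSetPartition v)
isSetPartition? v = all? (λ i → (toℕ (lookup v i) ℕ.≤? toℕ i) ×-dec (lookup v (lookup v i) ≟ lookup v i))

SetPartition : ℕ → Set
SetPartition n = Σ (Vec (Fin n) n) (λ v → True (isSetPartition? v))

SameBlock : ∀ {n} → SetPartition n → Fin n → Fin n → Set
SameBlock (v , _) i j = lookup v i ≡ lookup v j

-- Π_n ≀ C_c : a set partition together with a colour (in Fin c) for each element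
ColoredPartition : ℕ → ℕ → Set
ColoredPartition n c = SetPartition n × Vec (Fin c) n

EqContains11 : ∀ {n c} → Fin c → ColoredPartition n c → Set
EqContains11 {n} a (π , col) =
  ∃ λ (i : Fin n) → ∃ λ (j : Fin n) →
    (i ≢ j) × SameBlock π i j × (lookup col i ≡ a) × (lookup col j ≡ a)

eqContains11? : ∀ {n c} (a : Fin c) (x : ColoredPartition n c) → Dec (EqContains11 a x)
eqContains11? a ((v , _) , col) =
  any? (λ i → any? (λ j →
    ¬? (i ≟ j) ×-dec (lookup v i ≟ lookup v j) ×-dec (lookup col i ≟ a) ×-dec (lookup col j ≟ a)))

EqAvoids11 : ∀ {n c} → Fin c → ColoredPartition n c → Set
EqAvoids11 a x = ¬ EqContains11 a x

EqAvoiders : (n c : ℕ) → Fin c → Set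
EqAvoiders n c a = Σ (ColoredPartition n c) (λ x → True (¬? (eqContains11? a x)))

S : ℕ → ℕ → ℕ
S zero    zero    = 1
S zero    (suc k) = 0
S (suc p) zero    = 0
S (suc p) (suc k) = suc k * S p (suc k) + S p k

B : ℕ → ℕ
B m = sum (map (S m) (upTo (suc m)))

-- Σ_{k=lo}^{hi} f k   (empty if hi < lo)
sumFromTo : ℕ → ℕ → (ℕ → ℕ) → ℕ
sumFromTo lo hi f = sum (map f (applyUpTo (lo +_) (suc hi ∸ lo)))

multinomial : ℕ → ℕ → ℕ → ℕ
multinomial n i j = (n !) / (i ! * j ! * (n ∸ i ∸ j) !)
  where instance
    _ = m*n≢0 (i ! * j !) ((n ∸ i ∸ j) !) {{m*n≢0 (i !) (j !) {{i !≢0}} {{j !≢0}}}} {{(n ∸ i ∸ j) !≢0}}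

inner : ℕ → ℕ → ℕ → ℕ → ℕ
inner n c i j =
  multinomial n i j *
  sumFromTo j (n ∸ i ∸ j) (λ p →
    ((n ∸ i ∸ j) C p) * S p j * (j !) * B (n ∸ i ∸ j ∸ p) * ((c ∸ 1) ^ (n ∸ i ∸ j)))

rhs : ℕ → ℕ → ℕ
rhs n c = sumFromTo 0 n (λ i → sumFromTo 0 n (λ j →
  if ⌊ i + 2 * j ℕ.≤? n ⌋ then inner n c i j else 0))

-- In a coloured partition avoiding 1^a1^a every block
-- contains at most one element of colour a, so every element has one of four
-- roles: a loner (colour a, alone in its block), a host (colour a, not alone),
-- a guest (another colour, in the block of a host) or an outsider (another
-- colour, in a block without colour a). The coloured partition is recovered
-- from the roles, the colours (among the c - 1 other than a) of the guests and
-- outsiders, the map sending each guest to its host, which is onto the hosts,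
-- and the set partition of the outsiders. Choosing the i loners, then the j
-- hosts, then the p guests among the remaining n - i - j elements gives the
-- summand C(n,i) C(n-i,j) C(n-i-j,p) (c-1)^(n-i-j) S(p,j) j! B(n-i-j-p); the
-- pairs with i + 2j > n contribute nothing since S(p,j) = 0 for p < j.
module Submission where

open import Defs
open import Data.Nat as ℕ using (ℕ; zero; suc; pred; _+_; _*_; _∸_; _^_; _!; _≤_; _<_; z≤n; s≤s; _/_; NonZero)
open import Data.Nat.Properties
  using (<-irrelevant; ≤-antisym; ≤-trans; ≤-reflexive; ≤-pred; ≤-<-trans; ≰⇒>; m≤n⇒m≤1+n; m≤m+n; m∸n≤m;
         +-identityʳ; +-monoʳ-≤; +-cancelˡ-<; +-∸-assoc; m+n∸m≡n; m+n∸n≡m; m+[n∸m]≡n; ∸-monoˡ-≤;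
         *-assoc; *-zeroʳ; *-distribˡ-+; m*n≢0; _!≢0)
open import Data.Nat.Combinatorics using (_C_; nCk+nC[k+1]≡[n+1]C[k+1]; k![n∸k]!∣n!)
open import Data.Nat.Combinatorics.Specification using (nCk≡n!/k![n-k]!; k>n⇒nCk≡0)
open import Data.Nat.DivMod using (m*n/n≡m; m/n*n≡m)
open import Data.Nat.ListAction using (sum)
open import Data.Nat.Tactic.RingSolver using (solve-∀)
open import Data.Fin using (Fin; toℕ; punchIn; punchOut)
open import Data.Fin.Properties
  using (+↔⊎; *↔×; 0↔⊥; all?; any?; _≟_; toℕ-injective; suc-injective;
         punchInᵢ≢i; punchOut-cong′; punchIn-punchOut; punchOut-punchIn)
open import Data.List as List using (applyUpTo)
open import Data.Vec using (Vec; []; _∷_; lookup; tabulate; map)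
open import Data.Vec.Properties using (tabulate∘lookup; tabulate-cong; lookup∘tabulate; lookup-map)
open import Data.Bool using (Bool; true; false; not; if_then_else_)
open import Data.Bool.Properties using (T-irrelevant)
open import Data.Maybe using (Maybe; just; nothing)
open import Data.Product using (Σ; ∃; _×_; _,_; proj₁; proj₂)
open import Data.Product.Function.Dependent.Propositional using (congˡ) renaming (cong to Σ-cong)
open import Data.Product.Function.NonDependent.Propositional using (_×-cong_)
open import Data.Sum using (_⊎_; inj₁; inj₂)
open import Data.Sum.Properties using (inj₁-injective; inj₂-injective; ≡-dec)
open import Data.Sum.Function.Propositional using (_⊎-cong_)
open import Data.Empty using (⊥; ⊥-elim)
open import Function using (_∘_; id; _⇔_; mk⇔; Equivalence)
open import Function.Bundles using (_↔_; mk↔ₛ′; Inverse)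
open import Function.Construct.Symmetry using (↔-sym)
open import Function.Construct.Composition using (_↔-∘_)
open import Function.Related.Propositional using (K-refl; K-reflexive; bijection)
open import Axiom.UniquenessOfIdentityProofs using (module Decidable⇒UIP)
open import Relation.Nullary using (Dec; yes; no; ¬_)
open import Relation.Nullary.Decidable using (True; toWitness; fromWitness; ¬?; _×-dec_; ⌊_⌋)
open import Relation.Binary.Definitions using (DecidableEquality)
open import Relation.Binary.PropositionalEquality
  using (_≡_; _≢_; refl; cong; cong₂; sym; trans; subst; subst₂; module ≡-Reasoning)

module ↔-Reasoning = Function.Related.Propositional.EquationalReasoning {k = bijection}

∑ : ℕ → (ℕ → ℕ) → ℕ
∑ zero    f = 0
∑ (suc m) f = f 0 + ∑ m (f ∘ suc)

sum-map-applyUpTo : ∀ m (f g : ℕ → ℕ) → sum (List.map f (applyUpTo g m)) ≡ ∑ m (f ∘ g)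
sum-map-applyUpTo zero    f g = refl
sum-map-applyUpTo (suc m) f g = cong (f (g 0) +_) (sum-map-applyUpTo m f (g ∘ suc))

∑-cong : ∀ m {f g : ℕ → ℕ} → (∀ p → p < m → f p ≡ g p) → ∑ m f ≡ ∑ m g
∑-cong zero    f≡g = refl
∑-cong (suc m) f≡g = cong₂ _+_ (f≡g 0 (s≤s z≤n)) (∑-cong m λ p p<m → f≡g (suc p) (s≤s p<m))

∑-zero : ∀ m {f : ℕ → ℕ} → (∀ p → p < m → f p ≡ 0) → ∑ m f ≡ 0
∑-zero zero    f≡0 = refl
∑-zero (suc m) f≡0 = cong₂ _+_ (f≡0 0 (s≤s z≤n)) (∑-zero m λ p p<m → f≡0 (suc p) (s≤s p<m))

∑-dropInitialZeros : ∀ j m (f : ℕ → ℕ) → (∀ p → p < j → f p ≡ 0) → ∑ m f ≡ ∑ (m ∸ j) (λ x → f (j + x))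
∑-dropInitialZeros zero    m       f f≡0 = refl
∑-dropInitialZeros (suc j) zero    f f≡0 = refl
∑-dropInitialZeros (suc j) (suc m) f f≡0 = trans (cong (_+ ∑ m (f ∘ suc)) (f≡0 0 (s≤s z≤n)))
  (∑-dropInitialZeros j m (f ∘ suc) λ p p<j → f≡0 (suc p) (s≤s p<j))

∑-dropFinalZeros : ∀ m m′ (f : ℕ → ℕ) → m ≤ m′ → (∀ p → m ≤ p → p < m′ → f p ≡ 0) → ∑ m′ f ≡ ∑ m f
∑-dropFinalZeros zero    m′       f _         f≡0 = ∑-zero m′ λ p → f≡0 p z≤n
∑-dropFinalZeros (suc m) (suc m′) f (s≤s m≤m′) f≡0 =
  cong (f 0 +_) (∑-dropFinalZeros m m′ (f ∘ suc) m≤m′ λ p m≤p p<m′ → f≡0 (suc p) (s≤s m≤p) (s≤s p<m′))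

∑-*-distribˡ : ∀ m c (f : ℕ → ℕ) → ∑ m (λ p → c * f p) ≡ c * ∑ m f
∑-*-distribˡ zero    c f = sym (*-zeroʳ c)
∑-*-distribˡ (suc m) c f = trans (cong (c * f 0 +_) (∑-*-distribˡ m c (f ∘ suc))) (sym (*-distribˡ-+ c (f 0) _))

sumFromTo≡∑ : ∀ lo hi f → sumFromTo lo hi f ≡ ∑ (suc hi ∸ lo) (λ x → f (lo + x))
sumFromTo≡∑ lo hi f = sum-map-applyUpTo (suc hi ∸ lo) f (lo +_)

Σ< : ℕ → (ℕ → Set) → Set
Σ< m A = Σ ℕ λ k → k < m × A k

Σ<-zero : ∀ {A : ℕ → Set} → Σ< 0 A ↔ ⊥
Σ<-zero = mk↔ₛ′ (λ { (_ , () , _) }) (λ ()) (λ ()) (λ { (_ , () , _) })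

Σ<-suc : ∀ {m} {A : ℕ → Set} → Σ< (suc m) A ↔ (A 0 ⊎ Σ< m (A ∘ suc))
Σ<-suc {m} {A} = mk↔ₛ′ to from to∘from from∘to
  where
  to : Σ< (suc m) A → A 0 ⊎ Σ< m (A ∘ suc)
  to (zero  , _       , x) = inj₁ x
  to (suc k , s≤s k<m , x) = inj₂ (k , k<m , x)
  from : A 0 ⊎ Σ< m (A ∘ suc) → Σ< (suc m) A
  from (inj₁ x)             = zero , s≤s z≤n , x
  from (inj₂ (k , k<m , x)) = suc k , s≤s k<m , x
  to∘from : ∀ y → to (from y) ≡ y
  to∘from (inj₁ _) = refl
  to∘from (inj₂ _) = refl
  from∘to : ∀ x → from (to x) ≡ x
  from∘to (zero  , s≤s z≤n , _) = refl
  from∘to (suc k , s≤s _   , _) = refl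

Fin-∑ : ∀ m (f : ℕ → ℕ) → Fin (∑ m f) ↔ Σ< m (Fin ∘ f)
Fin-∑ zero    f = ↔-sym Σ<-zero ↔-∘ 0↔⊥
Fin-∑ (suc m) f = begin
  Fin (f 0 + ∑ m (f ∘ suc))          ↔⟨ +↔⊎ ⟩
  (Fin (f 0) ⊎ Fin (∑ m (f ∘ suc)))  ↔⟨ K-refl ⊎-cong Fin-∑ m (f ∘ suc) ⟩
  (Fin (f 0) ⊎ Σ< m (Fin ∘ f ∘ suc)) ↔⟨ Σ<-suc ⟨
  Σ< (suc m) (Fin ∘ f)               ∎
  where open ↔-Reasoning

Σ<-Fin : ∀ m {A : ℕ → Set} (f : ℕ → ℕ) → (∀ k → A k ↔ Fin (f k)) → Σ< m A ↔ Fin (∑ m f)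
Σ<-Fin m f A↔f = ↔-sym (Fin-∑ m f) ↔-∘ congˡ (K-refl ×-cong A↔f _)

Σ-bounded : ∀ m {A : ℕ → Set} → (∀ k → A k → k < m) → Σ ℕ A ↔ Σ< m A
Σ-bounded m {A} bound = mk↔ₛ′ to from to∘from (λ _ → refl)
  where
  to : Σ ℕ A → Σ< m A
  to (k , x) = k , bound k x , x
  from : Σ< m A → Σ ℕ A
  from (k , _ , x) = k , x
  to∘from : ∀ y → to (from y) ≡ y
  to∘from (k , k<m , x) = cong (λ k<m′ → k , k<m′ , x) (<-irrelevant (bound k x) k<m)

Σ-fibres : ∀ {A B : Set} {P : B → Set} (h : A → B) →
           Σ A (P ∘ h) ↔ Σ B (λ b → (Σ A λ a → h a ≡ b) × P b)
Σ-fibres {A} {B} {P} h = mk↔ₛ′ to from to∘from (λ _ → refl)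
  where
  to : Σ A (P ∘ h) → Σ B (λ b → (Σ A λ a → h a ≡ b) × P b)
  to (a , p) = h a , (a , refl) , p
  from : Σ B (λ b → (Σ A λ a → h a ≡ b) × P b) → Σ A (P ∘ h)
  from (_ , (a , refl) , p) = a , p
  to∘from : ∀ y → to (from y) ≡ y
  to∘from (_ , (a , refl) , p) = refl

count : ∀ {X : Set} {n} → (X → Bool) → Vec X n → ℕ
count p []       = 0
count p (x ∷ xs) = if p x then suc (count p xs) else count p xs

count≤length : ∀ {X : Set} {n} (p : X → Bool) (xs : Vec X n) → count p xs ≤ n
count≤length p []       = z≤n
count≤length p (x ∷ xs) with p x
... | true  = s≤s (count≤length p xs)
... | false = m≤n⇒m≤1+n (count≤length p xs)

trues falses : ∀ {n} → Vec Bool n → ℕ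
trues  = count id
falses = count not

falses≡length∸trues : ∀ {n} (s : Vec Bool n) → falses s ≡ n ∸ trues s
falses≡length∸trues []          = refl
falses≡length∸trues (true  ∷ s) = falses≡length∸trues s
falses≡length∸trues (false ∷ s) =
  trans (cong suc (falses≡length∸trues s)) (sym (+-∸-assoc 1 (count≤length id s)))

Combination : ℕ → ℕ → Set
Combination n k = Σ (Vec Bool n) λ s → trues s ≡ k

Combination↔C : ∀ n k → Combination n k ↔ Fin (n C k)
Combination↔C zero    zero    = mk↔ₛ′ (λ _ → Fin.zero) (λ _ → [] , refl) (λ { Fin.zero → refl ; (Fin.suc ()) }) (λ { ([] , refl) → refl })
Combination↔C zero    (suc k) = mk↔ₛ′ (λ { ([] , ()) }) (λ ()) (λ ()) (λ { ([] , ()) })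
Combination↔C (suc n) zero    = Combination↔C n zero ↔-∘ mk↔ₛ′ to from (λ _ → refl) from∘to
  where
  to : Combination (suc n) zero → Combination n zero
  to (false ∷ s , e) = s , e
  to (true  ∷ s , ())
  from : Combination n zero → Combination (suc n) zero
  from (s , e) = false ∷ s , e
  from∘to : ∀ x → from (to x) ≡ x
  from∘to (false ∷ s , e) = refl
  from∘to (true  ∷ s , ())
Combination↔C (suc n) (suc k) = begin
  Combination (suc n) (suc k)               ↔⟨ mk↔ₛ′ to from to∘from from∘to ⟩
  (Combination n k ⊎ Combination n (suc k)) ↔⟨ Combination↔C n k ⊎-cong Combination↔C n (suc k) ⟩
  (Fin (n C k) ⊎ Fin (n C suc k))           ↔⟨ +↔⊎ ⟨
  Fin (n C k + n C suc k)                   ≡⟨ cong Fin (nCk+nC[k+1]≡[n+1]C[k+1] n k) ⟩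
  Fin (suc n C suc k)                       ∎
  where
  open ↔-Reasoning
  to : Combination (suc n) (suc k) → Combination n k ⊎ Combination n (suc k)
  to (true  ∷ s , e) = inj₁ (s , cong pred e)
  to (false ∷ s , e) = inj₂ (s , e)
  from : Combination n k ⊎ Combination n (suc k) → Combination (suc n) (suc k)
  from (inj₁ (s , e)) = true ∷ s , cong suc e
  from (inj₂ (s , e)) = false ∷ s , e
  to∘from : ∀ y → to (from y) ≡ y
  to∘from (inj₁ (s , refl)) = refl
  to∘from (inj₂ (s , e))    = refl
  from∘to : ∀ x → from (to x) ≡ x
  from∘to (true  ∷ s , refl) = refl
  from∘to (false ∷ s , e)    = refl

group-by-trues : ∀ m (G : ℕ → ℕ → Set) →
                 Σ (Vec Bool m) (λ s → G (trues s) (falses s)) ↔ Σ< (suc m) (λ k → Combination m k × G k (m ∸ k))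
group-by-trues m G = begin
  Σ (Vec Bool m) (λ s → G (trues s) (falses s))              ↔⟨ congˡ (λ {s} → K-reflexive (cong (G (trues s)) (falses≡length∸trues s))) ⟩
  Σ (Vec Bool m) (λ s → G (trues s) (m ∸ trues s))           ↔⟨ Σ-fibres trues ⟩
  Σ ℕ (λ k → Combination m k × G k (m ∸ k))                  ↔⟨ Σ-bounded (suc m) (λ { k ((s , refl) , _) → s≤s (count≤length id s) }) ⟩
  Σ< (suc m) (λ k → Combination m k × G k (m ∸ k))           ∎
  where open ↔-Reasoning

Σ-Vec-Bool↔∑C : ∀ m (G : ℕ → ℕ → Set) (f : ℕ → ℕ) → (∀ k → G k (m ∸ k) ↔ Fin (f k)) →
                Σ (Vec Bool m) (λ s → G (trues s) (falses s)) ↔ Fin (∑ (suc m) λ k → (m C k) * f k)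
Σ-Vec-Bool↔∑C m G f G↔f = Σ<-Fin (suc m) (λ k → (m C k) * f k) (λ k → ↔-sym *↔× ↔-∘ (Combination↔C m k ×-cong G↔f k))
                          ↔-∘ group-by-trues m G

≗-lookup⇒≡ : ∀ {A : Set} {n} {v w : Vec A n} → (∀ i → lookup v i ≡ lookup w i) → v ≡ w
≗-lookup⇒≡ {v = v} {w} h = trans (sym (tabulate∘lookup v)) (trans (tabulate-cong h) (tabulate∘lookup w))

Σ-True-≡ : ∀ {A : Set} {P : A → Set} (P? : ∀ x → Dec (P x)) {x y : Σ A (True ∘ P?)} → proj₁ x ≡ proj₁ y → x ≡ y
Σ-True-≡ P? {a , p} {.a , q} refl = cong (a ,_) (T-irrelevant p q)

Vec↔^ : ∀ d q → Vec (Fin d) q ↔ Fin (d ^ q)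
Vec↔^ d zero    = mk↔ₛ′ (λ _ → Fin.zero) (λ _ → []) (λ { Fin.zero → refl ; (Fin.suc ()) }) (λ { [] → refl })
Vec↔^ d (suc q) = begin
  Vec (Fin d) (suc q)       ↔⟨ mk↔ₛ′ (λ { (x ∷ xs) → x , xs }) (λ (x , xs) → x ∷ xs) (λ _ → refl) (λ { (x ∷ xs) → refl }) ⟩
  (Fin d × Vec (Fin d) q)   ↔⟨ K-refl ×-cong Vec↔^ d q ⟩
  (Fin d × Fin (d ^ q))     ↔⟨ *↔× ⟨
  Fin (d ^ suc q)           ∎
  where open ↔-Reasoning

-- Restricted growth strings: element 0 either opens a new block, numbered 0,
-- or joins one of the blocks of the remaining elements.
data RGS : ℕ → ℕ → Set where
  []  : RGS 0 0
  new : ∀ {n b} → RGS n b → RGS (suc n) (suc b)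
  old : ∀ {n b} → Fin b → RGS n b → RGS (suc n) b

RGS↔S : ∀ n b → RGS n b ↔ Fin (S n b)
RGS↔S zero    zero    = mk↔ₛ′ (λ _ → Fin.zero) (λ _ → []) (λ { Fin.zero → refl ; (Fin.suc ()) }) (λ { [] → refl })
RGS↔S zero    (suc b) = mk↔ₛ′ (λ ()) (λ ()) (λ ()) (λ ())
RGS↔S (suc n) zero    = mk↔ₛ′ (λ { (old () _) }) (λ ()) (λ ()) (λ { (old () _) })
RGS↔S (suc n) (suc b) = begin
  RGS (suc n) (suc b)                          ↔⟨ mk↔ₛ′ to from to∘from from∘to ⟩
  (Fin (suc b) × RGS n (suc b) ⊎ RGS n b)      ↔⟨ (K-refl ×-cong RGS↔S n (suc b)) ⊎-cong RGS↔S n b ⟩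
  (Fin (suc b) × Fin (S n (suc b)) ⊎ Fin (S n b)) ↔⟨ ↔-sym *↔× ⊎-cong K-refl ⟩
  (Fin (suc b * S n (suc b)) ⊎ Fin (S n b))    ↔⟨ +↔⊎ ⟨
  Fin (S (suc n) (suc b))                      ∎
  where
  open ↔-Reasoning
  to : RGS (suc n) (suc b) → Fin (suc b) × RGS n (suc b) ⊎ RGS n b
  to (new g)   = inj₂ g
  to (old l g) = inj₁ (l , g)
  from : Fin (suc b) × RGS n (suc b) ⊎ RGS n b → RGS (suc n) (suc b)
  from (inj₁ (l , g)) = old l g
  from (inj₂ g)       = new g
  to∘from : ∀ y → to (from y) ≡ y
  to∘from (inj₁ _) = refl
  to∘from (inj₂ _) = refl
  from∘to : ∀ x → from (to x) ≡ x
  from∘to (new g)   = refl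
  from∘to (old l g) = refl

blocks≤length : ∀ {n b} → RGS n b → b ≤ n
blocks≤length []        = z≤n
blocks≤length (new g)   = s≤s (blocks≤length g)
blocks≤length (old _ g) = m≤n⇒m≤1+n (blocks≤length g)

Partition : ℕ → Set
Partition n = Σ ℕ (RGS n)

Partition↔B : ∀ m → Partition m ↔ Fin (B m)
Partition↔B m = begin
  Partition m                        ↔⟨ Σ-bounded (suc m) (λ _ g → s≤s (blocks≤length g)) ⟩
  Σ< (suc m) (RGS m)                 ↔⟨ Σ<-Fin (suc m) (S m) (RGS↔S m) ⟩
  Fin (∑ (suc m) (S m))              ≡⟨ cong Fin (sym (sum-map-applyUpTo (suc m) (S m) id)) ⟩
  Fin (B m)                          ∎
  where open ↔-Reasoning

IsOnto : ∀ {p j} → Vec (Fin j) p → Set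
IsOnto {p} s = ∀ y → ∃ λ (k : Fin p) → lookup s k ≡ y

isOnto? : ∀ {p j} (s : Vec (Fin j) p) → Dec (IsOnto s)
isOnto? s = all? (λ y → any? (λ k → lookup s k ≟ y))

Onto : ℕ → ℕ → Set
Onto p j = Σ (Vec (Fin j) p) (True ∘ isOnto?)

module _ {p j : ℕ} where

  ∷-onto : ∀ y {w : Vec (Fin j) p} → IsOnto w → IsOnto (y ∷ w)
  ∷-onto y onto z = let k , e = onto z in Fin.suc k , e

  onto-without-tail-onto : ∀ {y} {w : Vec (Fin j) p} → IsOnto (y ∷ w) → ¬ IsOnto w → ∀ k → y ≢ lookup w k
  onto-without-tail-onto {w = w} onto ¬onto k y≡wk = ¬onto tail-onto
    where
    tail-onto : IsOnto w
    tail-onto z with onto z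
    ... | Fin.zero   , e = k , trans (sym y≡wk) e
    ... | Fin.suc k′ , e = k′ , e

module _ {p j : ℕ} (y : Fin (suc j)) where

  punchOut-tail : (w : Vec (Fin (suc j)) p) → (∀ k → y ≢ lookup w k) → Vec (Fin j) p
  punchOut-tail w avoids = tabulate (λ k → punchOut (avoids k))

  punchOut-tail-onto : ∀ {w} (avoids : ∀ k → y ≢ lookup w k) → IsOnto (y ∷ w) → IsOnto (punchOut-tail w avoids)
  punchOut-tail-onto avoids onto z with onto (punchIn y z)
  ... | Fin.zero  , e = ⊥-elim (punchInᵢ≢i y z (sym e))
  ... | Fin.suc k , e = k , trans (lookup∘tabulate _ k) (trans (punchOut-cong′ y e) (punchOut-punchIn y))

  punchIn-tail-onto : ∀ {w : Vec (Fin j) p} → IsOnto w → IsOnto (y ∷ map (punchIn y) w)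
  punchIn-tail-onto {w} onto z with z ≟ y
  ... | yes refl = Fin.zero , refl
  ... | no z≢y   = let k , e = onto (punchOut (z≢y ∘ sym)) in
    Fin.suc k , trans (lookup-map k (punchIn y) w) (trans (cong (punchIn y) e) (punchIn-punchOut _))

  punchIn-tail-not-onto : ∀ (w : Vec (Fin j) p) → ¬ IsOnto (map (punchIn y) w)
  punchIn-tail-not-onto w onto = let k , e = onto y in
    punchInᵢ≢i y (lookup w k) (trans (sym (lookup-map k (punchIn y) w)) e)

-- The first value y of an onto vector either recurs in the tail (which is
-- then onto), or does not (and the tail, with y punched out, is onto Fin j).
Onto-suc↔ : ∀ p j → Onto (suc p) (suc j) ↔ (Fin (suc j) × (Onto p (suc j) ⊎ Onto p j))
Onto-suc↔ p j = mk↔ₛ′ to from to∘from from∘to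
  where
  split : ∀ y w → IsOnto (y ∷ w) → Dec (IsOnto w) → Fin (suc j) × (Onto p (suc j) ⊎ Onto p j)
  split y w onto (yes onto′) = y , inj₁ (w , fromWitness onto′)
  split y w onto (no ¬onto)  = y , inj₂ (punchOut-tail y w avoids , fromWitness (punchOut-tail-onto y avoids onto))
    where
    avoids : ∀ k → y ≢ lookup w k
    avoids = onto-without-tail-onto onto ¬onto
  to : Onto (suc p) (suc j) → Fin (suc j) × (Onto p (suc j) ⊎ Onto p j)
  to (y ∷ w , onto) = split y w (toWitness onto) (isOnto? w)
  from : Fin (suc j) × (Onto p (suc j) ⊎ Onto p j) → Onto (suc p) (suc j)
  from (y , inj₁ (w , onto)) = y ∷ w , fromWitness (∷-onto y (toWitness onto))
  from (y , inj₂ (w , onto)) = y ∷ map (punchIn y) w , fromWitness (punchIn-tail-onto y (toWitness onto))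
  to∘from : ∀ x → to (from x) ≡ x
  to∘from (y , inj₁ (w , onto)) = recurs _ (isOnto? w)
    where
    recurs : ∀ onto′ d → split y w onto′ d ≡ (y , inj₁ (w , onto))
    recurs _ (yes _)     = cong (λ v → y , inj₁ v) (Σ-True-≡ isOnto? refl)
    recurs _ (no ¬onto)  = ⊥-elim (¬onto (toWitness onto))
  to∘from (y , inj₂ (w , onto)) = avoids _ (isOnto? (map (punchIn y) w))
    where
    avoids : ∀ onto′ d → split y (map (punchIn y) w) onto′ d ≡ (y , inj₂ (w , onto))
    avoids _ (yes onto′) = ⊥-elim (punchIn-tail-not-onto y w onto′)
    avoids _ (no _)      = cong (λ v → y , inj₂ v) (Σ-True-≡ isOnto? (≗-lookup⇒≡ λ k →
      trans (lookup∘tabulate _ k) (trans (punchOut-cong′ y (lookup-map k (punchIn y) w)) (punchOut-punchIn y))))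
  from∘to : ∀ x → from (to x) ≡ x
  from∘to (y ∷ w , onto) = from∘split (isOnto? w)
    where
    from∘split : ∀ d → from (split y w (toWitness onto) d) ≡ (y ∷ w , onto)
    from∘split (yes _)    = Σ-True-≡ isOnto? refl
    from∘split (no ¬onto) = Σ-True-≡ isOnto? (cong (y ∷_) (≗-lookup⇒≡ λ k →
      trans (lookup-map k (punchIn y) (punchOut-tail y w avoids))
            (trans (cong (punchIn y) (lookup∘tabulate (λ k → punchOut (avoids k)) k)) (punchIn-punchOut _))))
      where
      avoids : ∀ k → y ≢ lookup w k
      avoids = onto-without-tail-onto (toWitness onto) ¬onto

Onto↔S*! : ∀ p j → Onto p j ↔ Fin (S p j * j !)
Onto↔S*! zero    zero    = mk↔ₛ′ (λ _ → Fin.zero) (λ _ → [] , _) (λ { Fin.zero → refl ; (Fin.suc ()) }) (λ { ([] , _) → refl })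
Onto↔S*! zero    (suc j) = mk↔ₛ′ (λ { ([] , ()) }) (λ ()) (λ ()) (λ { ([] , ()) })
Onto↔S*! (suc p) zero    = mk↔ₛ′ (λ { (() ∷ _ , _) }) (λ ()) (λ ()) (λ { (() ∷ _ , _) })
Onto↔S*! (suc p) (suc j) = begin
  Onto (suc p) (suc j)                                   ↔⟨ Onto-suc↔ p j ⟩
  (Fin (suc j) × (Onto p (suc j) ⊎ Onto p j))            ↔⟨ K-refl ×-cong (Onto↔S*! p (suc j) ⊎-cong Onto↔S*! p j) ⟩
  (Fin (suc j) × (Fin (x * (suc j) !) ⊎ Fin (y * j !)))  ↔⟨ K-refl ×-cong ↔-sym +↔⊎ ⟩
  (Fin (suc j) × Fin (x * (suc j) ! + y * j !))          ↔⟨ *↔× ⟨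
  Fin (suc j * (x * (suc j) ! + y * j !))                ≡⟨ cong Fin (recurrence x y j (j !)) ⟩
  Fin (S (suc p) (suc j) * (suc j) !)                    ∎
  where
  open ↔-Reasoning
  x y : ℕ
  x = S p (suc j)
  y = S p j
  recurrence : ∀ x y j f → suc j * (x * (f + j * f) + y * f) ≡ (x + j * x + y) * (f + j * f)
  recurrence = solve-∀

Least : ∀ {n} → (Fin n → Set) → Set
Least {n} P = Σ (Fin n) λ m → P m × (∀ j → P j → toℕ m ≤ toℕ j)

least : ∀ {n} {P : Fin n → Set} → (∀ j → Dec (P j)) → ∃ P → Least P
least {suc n} P? (i , Pi) with P? Fin.zero | i
... | yes P0 | _       = Fin.zero , P0 , λ _ _ → z≤n
... | no ¬P0 | Fin.zero = ⊥-elim (¬P0 Pi)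
... | no ¬P0 | Fin.suc i′ with least (P? ∘ Fin.suc) (i′ , Pi)
... | m , Pm , minimal = Fin.suc m , Pm , λ where
  Fin.zero    Pj → ⊥-elim (¬P0 Pj)
  (Fin.suc j) Pj → s≤s (minimal j Pj)

Least-unique : ∀ {n} {P Q : Fin n → Set} → (∀ j → P j → Q j) → (∀ j → Q j → P j) →
               (x : Least P) (y : Least Q) → proj₁ x ≡ proj₁ y
Least-unique P⇒Q Q⇒P (m , Pm , m-min) (m′ , Qm′ , m′-min) =
  toℕ-injective (≤-antisym (m-min m′ (Q⇒P m′ Qm′)) (m′-min m (P⇒Q m Pm)))

module KeyPartition {K : Set} (_≟K_ : DecidableEquality K) {n} (key : Fin n → K) where

  leastWithKeyOf : ∀ i → Least (λ j → key j ≡ key i)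
  leastWithKeyOf i = least (λ j → key j ≟K key i) (i , refl)

  leader : Fin n → Fin n
  leader i = proj₁ (leastWithKeyOf i)

  key-leader : ∀ i → key (leader i) ≡ key i
  key-leader i = proj₁ (proj₂ (leastWithKeyOf i))

  leader-cong : ∀ {i i′} → key i ≡ key i′ → leader i ≡ leader i′
  leader-cong e = Least-unique (λ _ h → trans h e) (λ _ h → trans h (sym e)) (leastWithKeyOf _) (leastWithKeyOf _)

  partition : SetPartition n
  partition = tabulate leader , fromWitness isSetPartition
    where
    isSetPartition : IsSetPartition (tabulate leader)
    isSetPartition i rewrite lookup∘tabulate leader i =
      proj₂ (proj₂ (leastWithKeyOf i)) i refl ,
      trans (lookup∘tabulate leader (leader i)) (leader-cong (key-leader i))

  sameBlock⇒≡ : ∀ i j → SameBlock partition i j → key i ≡ key j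
  sameBlock⇒≡ i j e = begin
    key i                         ≡⟨ key-leader i ⟨
    key (leader i)                ≡⟨ cong key (trans (sym (lookup∘tabulate leader i)) (trans e (lookup∘tabulate leader j))) ⟩
    key (leader j)                ≡⟨ key-leader j ⟩
    key j                         ∎
    where open ≡-Reasoning

  ≡⇒sameBlock : ∀ i j → key i ≡ key j → SameBlock partition i j
  ≡⇒sameBlock i j e = trans (lookup∘tabulate leader i) (trans (leader-cong e) (sym (lookup∘tabulate leader j)))

SetPartition-≡ : ∀ {n} (π π′ : SetPartition n) →
                 (∀ i j → SameBlock π i j → SameBlock π′ i j) → (∀ i j → SameBlock π′ i j → SameBlock π i j) → π ≡ π′
SetPartition-≡ π@(v , p) π′@(v′ , p′) π⇒π′ π′⇒π = Σ-True-≡ isSetPartition? (≗-lookup⇒≡ same-leader)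
  where
  same-leader : ∀ i → lookup v i ≡ lookup v′ i
  same-leader i = toℕ-injective (≤-antisym r≤r′ r′≤r)
    where
    r = lookup v i
    r′ = lookup v′ i
    r≤r′ : toℕ r ≤ toℕ r′
    r≤r′ = subst (λ z → toℕ z ≤ toℕ r′) (π′⇒π r′ i (proj₂ (toWitness p′ i))) (proj₁ (toWitness p r′))
    r′≤r : toℕ r′ ≤ toℕ r
    r′≤r = subst (λ z → toℕ z ≤ toℕ r) (π⇒π′ r i (proj₂ (toWitness p i))) (proj₁ (toWitness p′ r))

block : ∀ {n b} → RGS n b → Fin n → Fin b
block (new g)   Fin.zero    = Fin.zero
block (new g)   (Fin.suc i) = Fin.suc (block g i)
block (old l g) Fin.zero    = l
block (old l g) (Fin.suc i) = block g i

block-onto : ∀ {n b} (g : RGS n b) (l : Fin b) → ∃ λ i → block g i ≡ l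
block-onto (new g)    Fin.zero    = Fin.zero , refl
block-onto (new g)    (Fin.suc l) = let i , e = block-onto g l in Fin.suc i , cong Fin.suc e
block-onto (old _ g)  l           = let i , e = block-onto g l in Fin.suc i , e

Refines : ∀ {n} → Partition n → Partition n → Set
Refines {n} (_ , g) (_ , g′) = ∀ (i j : Fin n) → block g i ≡ block g j → block g′ i ≡ block g′ j

Partition-≡ : ∀ {n} (π π′ : Partition n) → Refines π π′ → Refines π′ π → π ≡ π′
Partition-≡ (_ , [])      (_ , [])       _ _ = refl
Partition-≡ (_ , new g)   (_ , new g′)   π⇒π′ π′⇒π
  with refl ← Partition-≡ (_ , g) (_ , g′) (λ i j e → suc-injective (π⇒π′ (Fin.suc i) (Fin.suc j) (cong Fin.suc e)))
                                          (λ i j e → suc-injective (π′⇒π (Fin.suc i) (Fin.suc j) (cong Fin.suc e)))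
  = refl
Partition-≡ (_ , new g)   (_ , old l′ g′) _ π′⇒π with i , e ← block-onto g′ l′ with () ← π′⇒π Fin.zero (Fin.suc i) (sym e)
Partition-≡ (_ , old l g) (_ , new g′)   π⇒π′ _ with i , e ← block-onto g l with () ← π⇒π′ Fin.zero (Fin.suc i) (sym e)
Partition-≡ (_ , old l g) (_ , old l′ g′) π⇒π′ π′⇒π
  with refl ← Partition-≡ (_ , g) (_ , g′) (λ i j → π⇒π′ (Fin.suc i) (Fin.suc j)) (λ i j → π′⇒π (Fin.suc i) (Fin.suc j))
  with i , e ← block-onto g l
  = cong (λ l″ → _ , old l″ g) (sym (trans (π⇒π′ Fin.zero (Fin.suc i) (sym e)) e))

module KeyRGS {K : Set} (_≟K_ : DecidableEquality K) where

  BlocksAreFibres : ∀ {n} → (Fin n → K) → Partition n → Set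
  BlocksAreFibres key (_ , g) = ∀ i j → block g i ≡ block g j ⇔ key i ≡ key j

  partitionOf : ∀ {n} → (Fin n → K) → Partition n
  partitionOf {zero}  key = 0 , []
  partitionOf {suc n} key with partitionOf (key ∘ Fin.suc) | any? (λ i → key (Fin.suc i) ≟K key Fin.zero)
  ... | b , g | yes (i , _) = b , old (block g i) g
  ... | b , g | no _        = suc b , new g

  partitionOf-fibres : ∀ {n} (key : Fin n → K) → BlocksAreFibres key (partitionOf key)
  partitionOf-fibres {zero}  key ()
  partitionOf-fibres {suc n} key
    with partitionOf (key ∘ Fin.suc) | partitionOf-fibres (key ∘ Fin.suc) | any? (λ i → key (Fin.suc i) ≟K key Fin.zero)
  ... | b , g | ih | yes (i₀ , e₀) = λ where
    Fin.zero    Fin.zero    → mk⇔ (λ _ → refl) (λ _ → refl)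
    Fin.zero    (Fin.suc j) → mk⇔ (λ e → trans (sym e₀) (Equivalence.to (ih i₀ j) e)) (λ e → Equivalence.from (ih i₀ j) (trans e₀ e))
    (Fin.suc i) Fin.zero    → mk⇔ (λ e → trans (Equivalence.to (ih i i₀) e) e₀) (λ e → Equivalence.from (ih i i₀) (trans e (sym e₀)))
    (Fin.suc i) (Fin.suc j) → ih i j
  ... | b , g | ih | no none = λ where
    Fin.zero    Fin.zero    → mk⇔ (λ _ → refl) (λ _ → refl)
    Fin.zero    (Fin.suc j) → mk⇔ (λ ()) (λ e → ⊥-elim (none (j , sym e)))
    (Fin.suc i) Fin.zero    → mk⇔ (λ ()) (λ e → ⊥-elim (none (i , e)))
    (Fin.suc i) (Fin.suc j) → mk⇔ (Equivalence.to (ih i j) ∘ suc-injective) (cong Fin.suc ∘ Equivalence.from (ih i j))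

-- select t enumerates, in increasing order, the positions x of t with
-- p (lookup t x) ≡ true; rank is its inverse.
module Positions {X : Set} (p : X → Bool) where

  private
    CountAfter : Bool → ℕ → ℕ
    CountAfter b m = if b then suc m else m

    select-∷ : ∀ {m n} b → (Fin m → Fin n) → Fin (CountAfter b m) → Fin (suc n)
    select-∷ true  s Fin.zero    = Fin.zero
    select-∷ true  s (Fin.suc k) = Fin.suc (s k)
    select-∷ false s k           = Fin.suc (s k)

    rank-head : ∀ {m} b → b ≡ true → Fin (CountAfter b m)
    rank-head true _ = Fin.zero

    rank-tail : ∀ {m} b → Fin m → Fin (CountAfter b m)
    rank-tail true  k = Fin.suc k
    rank-tail false k = k

  select : ∀ {n} (t : Vec X n) → Fin (count p t) → Fin n
  select (x ∷ t) = select-∷ (p x) (select t)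

  rank : ∀ {n} (t : Vec X n) x → p (lookup t x) ≡ true → Fin (count p t)
  rank (y ∷ t) Fin.zero    py = rank-head (p y) py
  rank (y ∷ t) (Fin.suc x) px = rank-tail (p y) (rank t x px)

  select-satisfies : ∀ {n} (t : Vec X n) k → p (lookup t (select t k)) ≡ true
  select-satisfies (y ∷ t) = go (p y) refl
    where
    go : ∀ b → p y ≡ b → (k : Fin (CountAfter b (count p t))) → p (lookup (y ∷ t) (select-∷ b (select t) k)) ≡ true
    go true  py Fin.zero    = py
    go true  _  (Fin.suc k) = select-satisfies t k
    go false _  k           = select-satisfies t k

  select-rank : ∀ {n} (t : Vec X n) x px → select t (rank t x px) ≡ x
  select-rank (y ∷ t) Fin.zero    py = go (p y) py
    where
    go : ∀ b (pb : b ≡ true) → select-∷ b (select t) (rank-head b pb) ≡ Fin.zero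
    go true refl = refl
  select-rank (y ∷ t) (Fin.suc x) px = trans (go (p y) (rank t x px)) (cong Fin.suc (select-rank t x px))
    where
    go : ∀ b k → select-∷ b (select t) (rank-tail b k) ≡ Fin.suc (select t k)
    go true  k = refl
    go false k = refl

  select-injective : ∀ {n} (t : Vec X n) {k k′} → select t k ≡ select t k′ → k ≡ k′
  select-injective (y ∷ t) = go (p y)
    where
    go : ∀ b {k k′ : Fin (CountAfter b (count p t))} → select-∷ b (select t) k ≡ select-∷ b (select t) k′ → k ≡ k′
    go true  {Fin.zero}  {Fin.zero}   _ = refl
    go true  {Fin.suc k} {Fin.suc k′} e = cong Fin.suc (select-injective t (suc-injective e))
    go false                          e = select-injective t (suc-injective e)

  rank-select : ∀ {n} (t : Vec X n) k pk → rank t (select t k) pk ≡ k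
  rank-select t k pk = select-injective t (select-rank t (select t k) pk)

  rank-cong : ∀ {n} (t : Vec X n) {x x′} (px : p (lookup t x) ≡ true) (px′ : p (lookup t x′) ≡ true) →
              x ≡ x′ → rank t x px ≡ rank t x′ px′
  rank-cong t px px′ refl = cong (rank t _) (Decidable⇒UIP.≡-irrelevant Data.Bool.Properties._≟_ px px′)

  rank-injective : ∀ {n} (t : Vec X n) {x x′} (px : p (lookup t x) ≡ true) (px′ : p (lookup t x′) ≡ true) →
                   rank t x px ≡ rank t x′ px′ → x ≡ x′
  rank-injective t {x} {x′} px px′ e = trans (sym (select-rank t x px)) (trans (cong (select t) e) (select-rank t x′ px′))

-- Nested so that a vector of roles splits into the mask of loners, the mask
-- of hosts among the others, and the mask of guests among the rest.
Role : Set
Role = Maybe (Maybe Bool)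

pattern loner    = nothing
pattern host     = just nothing
pattern guest    = just (just true)
pattern outsider = just (just false)

host? guest? outsider? otherColour? : Role → Bool
host? host = true
host? _    = false
guest? (just (just b)) = b
guest? _               = false
outsider? (just (just b)) = not b
outsider? _               = false
otherColour? (just (just _)) = true
otherColour? _               = false

module Hosts        = Positions host?
module Guests       = Positions guest?
module Outsiders    = Positions outsider?
module OtherColours = Positions otherColour?

-- The data of an avoiding coloured partition with colours in Fin (suc d):
-- the roles, the colours (other than a) of guests and outsiders, the host of
-- each guest (every host has a guest), and the partition of the outsiders.
Decomposition : ℕ → ℕ → Set
Decomposition d n = Σ (Vec Role n) λ t →
  Vec (Fin d) (count otherColour? t) × Onto (count guest? t) (count host? t) × Partition (count outsider? t)

AtMostOneAPerBlock : ∀ {d n} → Fin (suc d) → Vec (Fin n) n → Vec (Fin (suc d)) n → Set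
AtMostOneAPerBlock a v col = ∀ i j → lookup v i ≡ lookup v j → lookup col i ≡ a → lookup col j ≡ a → i ≡ j

module RolesIn {d n : ℕ} (a : Fin (suc d)) (blockOf : Fin n → Fin n) (colour : Fin n → Fin (suc d)) where

  ColouredA Crowded NearA : Fin n → Set
  ColouredA x = colour x ≡ a
  Crowded   x = ∃ λ y → y ≢ x × blockOf y ≡ blockOf x
  NearA     x = ∃ λ y → blockOf y ≡ blockOf x × colour y ≡ a

  data HasRole (x : Fin n) : Role → Set where
    as-loner    : ColouredA x → ¬ Crowded x → HasRole x loner
    as-host     : ColouredA x → Crowded x → HasRole x host
    as-guest    : ¬ ColouredA x → NearA x → HasRole x guest
    as-outsider : ¬ ColouredA x → ¬ NearA x → HasRole x outsider

  HasRole-unique : ∀ {x τ τ′} → HasRole x τ → HasRole x τ′ → τ ≡ τ′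
  HasRole-unique (as-loner _ _)       (as-loner _ _)       = refl
  HasRole-unique (as-loner _ ¬c)      (as-host _ c)        = ⊥-elim (¬c c)
  HasRole-unique (as-loner ca _)      (as-guest ¬ca _)     = ⊥-elim (¬ca ca)
  HasRole-unique (as-loner ca _)      (as-outsider ¬ca _)  = ⊥-elim (¬ca ca)
  HasRole-unique (as-host _ c)        (as-loner _ ¬c)      = ⊥-elim (¬c c)
  HasRole-unique (as-host _ _)        (as-host _ _)        = refl
  HasRole-unique (as-host ca _)       (as-guest ¬ca _)     = ⊥-elim (¬ca ca)
  HasRole-unique (as-host ca _)       (as-outsider ¬ca _)  = ⊥-elim (¬ca ca)
  HasRole-unique (as-guest ¬ca _)     (as-loner ca _)      = ⊥-elim (¬ca ca)
  HasRole-unique (as-guest ¬ca _)     (as-host ca _)       = ⊥-elim (¬ca ca)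
  HasRole-unique (as-guest _ _)       (as-guest _ _)       = refl
  HasRole-unique (as-guest _ na)      (as-outsider _ ¬na)  = ⊥-elim (¬na na)
  HasRole-unique (as-outsider ¬ca _)  (as-loner ca _)      = ⊥-elim (¬ca ca)
  HasRole-unique (as-outsider ¬ca _)  (as-host ca _)       = ⊥-elim (¬ca ca)
  HasRole-unique (as-outsider _ ¬na)  (as-guest _ na)      = ⊥-elim (¬na na)
  HasRole-unique (as-outsider _ _)    (as-outsider _ _)    = refl

  private
    classify : ∀ {x} → Dec (ColouredA x) → Dec (Crowded x) → Dec (NearA x) → ∃ (HasRole x)
    classify (yes ca)  (yes c)  _         = host , as-host ca c
    classify (yes ca)  (no ¬c)  _         = loner , as-loner ca ¬c
    classify (no ¬ca)  _        (yes na)  = guest , as-guest ¬ca na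
    classify (no ¬ca)  _        (no ¬na)  = outsider , as-outsider ¬ca ¬na

  -- Opaque: only the specification proj₂ is ever needed, and unfolding the
  -- searches makes type checking impractically slow.
  opaque
    role : ∀ x → ∃ (HasRole x)
    role x = classify (colour x ≟ a)
                      (any? λ y → ¬? (y ≟ x) ×-dec (blockOf y ≟ blockOf x))
                      (any? λ y → (blockOf y ≟ blockOf x) ×-dec (colour y ≟ a))

module Decode {d} (a : Fin (suc d)) {n} (t : Vec Role n) (cs : Vec (Fin d) (count otherColour? t))
              (hostOf : Vec (Fin (count host? t)) (count guest? t)) {b} (g : RGS (count outsider? t) b) where

  open ≡-Reasoning

  -- Loners are keyed by themselves, hosts and their guests by the host, and
  -- outsiders by their block in g; the blocks are the fibres of the key.
  Key : Set
  Key = Fin n ⊎ (Fin (count host? t) ⊎ Fin b)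

  _≟Key_ : DecidableEquality Key
  _≟Key_ = ≡-dec _≟_ (≡-dec _≟_ _≟_)

  otherColour : ∀ x → otherColour? (lookup t x) ≡ true → Fin (suc d)
  otherColour x p = punchIn a (lookup cs (OtherColours.rank t x p))

  data View (x : Fin n) (κ : Key) (γ : Fin (suc d)) : Set where
    at-loner    : lookup t x ≡ loner → κ ≡ inj₁ x → γ ≡ a → View x κ γ
    at-host     : (h : lookup t x ≡ host) → κ ≡ inj₂ (inj₁ (Hosts.rank t x (cong host? h))) → γ ≡ a → View x κ γ
    at-guest    : (h : lookup t x ≡ guest) → κ ≡ inj₂ (inj₁ (lookup hostOf (Guests.rank t x (cong guest? h)))) →
                  γ ≡ otherColour x (cong otherColour? h) → View x κ γ
    at-outsider : (h : lookup t x ≡ outsider) → κ ≡ inj₂ (inj₂ (block g (Outsiders.rank t x (cong outsider? h)))) →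
                  γ ≡ otherColour x (cong otherColour? h) → View x κ γ

  -- Everything about key and colour is read off view, so they are kept abstract.
  abstract
    keyAt : ∀ x τ → lookup t x ≡ τ → Key
    keyAt x loner    e = inj₁ x
    keyAt x host     e = inj₂ (inj₁ (Hosts.rank t x (cong host? e)))
    keyAt x guest    e = inj₂ (inj₁ (lookup hostOf (Guests.rank t x (cong guest? e))))
    keyAt x outsider e = inj₂ (inj₂ (block g (Outsiders.rank t x (cong outsider? e))))

    colourAt : ∀ x τ → lookup t x ≡ τ → Fin (suc d)
    colourAt x loner           e = a
    colourAt x host            e = a
    colourAt x (just (just _)) e = otherColour x (cong otherColour? e)

    key : Fin n → Key
    key x = keyAt x (lookup t x) refl

    colour : Fin n → Fin (suc d)
    colour x = colourAt x (lookup t x) refl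

    view : ∀ x → View x (key x) (colour x)
    view x = viewAt (lookup t x) refl
      where
      viewAt : ∀ τ (e : lookup t x ≡ τ) → View x (keyAt x τ e) (colourAt x τ e)
      viewAt loner    e = at-loner e refl refl
      viewAt host     e = at-host e refl refl
      viewAt guest    e = at-guest e refl refl
      viewAt outsider e = at-outsider e refl refl

  open KeyPartition _≟Key_ key public using (partition; sameBlock⇒≡; ≡⇒sameBlock)

  colours : Vec (Fin (suc d)) n
  colours = tabulate colour

  otherColour≢a : ∀ {x p} → otherColour x p ≢ a
  otherColour≢a = punchInᵢ≢i a _

  sameKey-colourA⇒≡ : ∀ i j → key i ≡ key j → colour i ≡ a → colour j ≡ a → i ≡ j
  sameKey-colourA⇒≡ i j e ci cj with view i | view j
  ... | at-guest _ _ c    | _                = ⊥-elim (otherColour≢a (trans (sym c) ci))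
  ... | at-outsider _ _ c | _                = ⊥-elim (otherColour≢a (trans (sym c) ci))
  ... | _                 | at-guest _ _ c    = ⊥-elim (otherColour≢a (trans (sym c) cj))
  ... | _                 | at-outsider _ _ c = ⊥-elim (otherColour≢a (trans (sym c) cj))
  ... | at-loner _ k _    | at-loner _ k′ _   = inj₁-injective (trans (sym k) (trans e k′))
  ... | at-loner _ k _    | at-host _ k′ _    with () ← trans (sym k) (trans e k′)
  ... | at-host _ k _     | at-loner _ k′ _   with () ← trans (sym k) (trans e k′)
  ... | at-host _ k _     | at-host _ k′ _    =
    Hosts.rank-injective t _ _ (inj₁-injective (inj₂-injective (trans (sym k) (trans e k′))))

  decoded : EqAvoiders n (suc d) a
  decoded = (partition , colours) , fromWitness avoiding
    where
    avoiding : ¬ EqContains11 a (partition , colours)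
    avoiding (i , j , i≢j , same , ci , cj) = i≢j (sameKey-colourA⇒≡ i j (sameBlock⇒≡ i j same)
      (trans (sym (lookup∘tabulate colour i)) ci) (trans (sym (lookup∘tabulate colour j)) cj))

  key-host : ∀ x (p : host? (lookup t x) ≡ true) → key x ≡ inj₂ (inj₁ (Hosts.rank t x p))
  key-host x p with view x
  ... | at-host _ k _     = trans k (cong (inj₂ ∘ inj₁) (Hosts.rank-cong t _ _ refl))
  ... | at-loner h _ _    with () ← trans (sym (cong host? h)) p
  ... | at-guest h _ _    with () ← trans (sym (cong host? h)) p
  ... | at-outsider h _ _ with () ← trans (sym (cong host? h)) p

  key-guest : ∀ x (p : guest? (lookup t x) ≡ true) → key x ≡ inj₂ (inj₁ (lookup hostOf (Guests.rank t x p)))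
  key-guest x p with view x
  ... | at-guest _ k _    = trans k (cong (inj₂ ∘ inj₁ ∘ lookup hostOf) (Guests.rank-cong t _ _ refl))
  ... | at-loner h _ _    with () ← trans (sym (cong guest? h)) p
  ... | at-host h _ _     with () ← trans (sym (cong guest? h)) p
  ... | at-outsider h _ _ with () ← trans (sym (cong guest? h)) p

  key-outsider : ∀ x (p : outsider? (lookup t x) ≡ true) → key x ≡ inj₂ (inj₂ (block g (Outsiders.rank t x p)))
  key-outsider x p with view x
  ... | at-outsider _ k _ = trans k (cong (inj₂ ∘ inj₂ ∘ block g) (Outsiders.rank-cong t _ _ refl))
  ... | at-loner h _ _    with () ← trans (sym (cong outsider? h)) p
  ... | at-host h _ _     with () ← trans (sym (cong outsider? h)) p
  ... | at-guest h _ _    with () ← trans (sym (cong outsider? h)) p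

  colour-otherColour : ∀ x (p : otherColour? (lookup t x) ≡ true) → colour x ≡ otherColour x p
  colour-otherColour x p with view x
  ... | at-guest _ _ c    = trans c (cong (punchIn a ∘ lookup cs) (OtherColours.rank-cong t _ _ refl))
  ... | at-outsider _ _ c = trans c (cong (punchIn a ∘ lookup cs) (OtherColours.rank-cong t _ _ refl))
  ... | at-loner h _ _    with () ← trans (sym (cong otherColour? h)) p
  ... | at-host h _ _     with () ← trans (sym (cong otherColour? h)) p

  colour-host : ∀ x → host? (lookup t x) ≡ true → colour x ≡ a
  colour-host x p with view x
  ... | at-host _ _ c     = c
  ... | at-loner _ _ c    = c
  ... | at-guest h _ _    with () ← trans (sym (cong host? h)) p
  ... | at-outsider h _ _ with () ← trans (sym (cong host? h)) p

  colourA⇒key : ∀ x → colour x ≡ a → key x ≡ inj₁ x ⊎ ∃ λ l → key x ≡ inj₂ (inj₁ l)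
  colourA⇒key x ca with view x
  ... | at-loner _ k _    = inj₁ k
  ... | at-host _ k _     = inj₂ (_ , k)
  ... | at-guest _ _ c    = ⊥-elim (otherColour≢a (trans (sym c) ca))
  ... | at-outsider _ _ c = ⊥-elim (otherColour≢a (trans (sym c) ca))

  key-injective-at-loner : ∀ {y z} → key y ≡ inj₁ z → y ≡ z
  key-injective-at-loner {y} e with view y
  ... | at-loner _ k _    = inj₁-injective (trans (sym k) e)
  ... | at-host _ k _     with () ← trans (sym k) e
  ... | at-guest _ k _    with () ← trans (sym k) e
  ... | at-outsider _ k _ with () ← trans (sym k) e

  open RolesIn a (lookup (proj₁ partition)) (lookup colours)

  colours-lookup : ∀ x → lookup colours x ≡ colour x
  colours-lookup = lookup∘tabulate colour

  private
    notA : ∀ {x p} → colour x ≡ otherColour x p → ¬ ColouredA x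
    notA c ca = otherColour≢a (trans (sym c) (trans (sym (colours-lookup _)) ca))

  decoded-roles : IsOnto hostOf → ∀ x → HasRole x (lookup t x)
  decoded-roles onto x with view x
  ... | at-loner h k c = subst (HasRole x) (sym h) (as-loner (trans (colours-lookup x) c) alone)
    where
    alone : ¬ Crowded x
    alone (y , y≢x , same) = y≢x (key-injective-at-loner (trans (sameBlock⇒≡ y x same) k))
  ... | at-host h k c = subst (HasRole x) (sym h) (as-host (trans (colours-lookup x) c) (w , w≢x , same))
    where
    px : host? (lookup t x) ≡ true
    px = cong host? h
    guestIndex : Fin (count guest? t)
    guestIndex = proj₁ (onto (Hosts.rank t x px))
    w : Fin n
    w = Guests.select t guestIndex
    pw : guest? (lookup t w) ≡ true
    pw = Guests.select-satisfies t guestIndex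
    w≢x : w ≢ x
    w≢x w≡x with () ← trans (sym (cong guest? h)) (subst (λ y → guest? (lookup t y) ≡ true) w≡x pw)
    same : SameBlock partition w x
    same = ≡⇒sameBlock w x (begin
      key w                                                        ≡⟨ key-guest w pw ⟩
      inj₂ (inj₁ (lookup hostOf (Guests.rank t w pw)))             ≡⟨ cong (inj₂ ∘ inj₁ ∘ lookup hostOf) (Guests.rank-select t guestIndex pw) ⟩
      inj₂ (inj₁ (lookup hostOf guestIndex))                       ≡⟨ cong (inj₂ ∘ inj₁) (proj₂ (onto (Hosts.rank t x px))) ⟩
      inj₂ (inj₁ (Hosts.rank t x px))                              ≡⟨ key-host x px ⟨
      key x                                                        ∎)
  ... | at-guest h k c = subst (HasRole x) (sym h) (as-guest (notA c) (w , same , trans (colours-lookup w) (colour-host w pw)))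
    where
    l : Fin (count host? t)
    l = lookup hostOf (Guests.rank t x (cong guest? h))
    w : Fin n
    w = Hosts.select t l
    pw : host? (lookup t w) ≡ true
    pw = Hosts.select-satisfies t l
    same : SameBlock partition w x
    same = ≡⇒sameBlock w x (trans (key-host w pw) (trans (cong (inj₂ ∘ inj₁) (Hosts.rank-select t l pw)) (sym k)))
  ... | at-outsider h k c = subst (HasRole x) (sym h) (as-outsider (notA c) farFromA)
    where
    farFromA : ¬ NearA x
    farFromA (w , same , ca) with colourA⇒key w (trans (sym (colours-lookup w)) ca)
    ... | inj₁ kw       with () ← trans (sym kw) (trans (sameBlock⇒≡ w x same) k)
    ... | inj₂ (l , kw) with () ← trans (sym kw) (trans (sameBlock⇒≡ w x same) k)

module Encode {d} (a : Fin (suc d)) {n} (v : Vec (Fin n) n) (col : Vec (Fin (suc d)) n)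
              (avoids : AtMostOneAPerBlock a v col) where

  open RolesIn a (lookup v) (lookup col) public
  open ≡-Reasoning

  -- Parametrised by any correct vector of roles: the computed one is only
  -- propositionally equal to the roles a decoded partition was built from.
  module Given (t : Vec Role n) (roles : ∀ x → HasRole x (lookup t x)) where

    roleAt : ∀ x {τ} → lookup t x ≡ τ → HasRole x τ
    roleAt x e = subst (HasRole x) e (roles x)

    otherColour-≢a : ∀ x → otherColour? (lookup t x) ≡ true → a ≢ lookup col x
    otherColour-≢a x = go (roles x)
      where
      go : ∀ {τ} → HasRole x τ → otherColour? τ ≡ true → a ≢ lookup col x
      go (as-guest ¬ca _)    _ = ¬ca ∘ sym
      go (as-outsider ¬ca _) _ = ¬ca ∘ sym

    guest-nearA : ∀ x → guest? (lookup t x) ≡ true → NearA x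
    guest-nearA x = go (roles x)
      where
      go : ∀ {τ} → HasRole x τ → guest? τ ≡ true → NearA x
      go (as-guest _ na) _ = na

    hasRole-host : ∀ x → ColouredA x → Crowded x → host? (lookup t x) ≡ true
    hasRole-host x ca c = go (roles x)
      where
      go : ∀ {τ} → HasRole x τ → host? τ ≡ true
      go (as-host _ _)        = refl
      go (as-loner _ ¬c)      = ⊥-elim (¬c c)
      go (as-guest ¬ca _)     = ⊥-elim (¬ca ca)
      go (as-outsider ¬ca _)  = ⊥-elim (¬ca ca)

    hasRole-guest : ∀ x → ¬ ColouredA x → NearA x → guest? (lookup t x) ≡ true
    hasRole-guest x ¬ca na = go (roles x)
      where
      go : ∀ {τ} → HasRole x τ → guest? τ ≡ true
      go (as-guest _ _)       = refl
      go (as-loner ca _)      = ⊥-elim (¬ca ca)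
      go (as-host ca _)       = ⊥-elim (¬ca ca)
      go (as-outsider _ ¬na)  = ⊥-elim (¬na na)

    host-crowded : ∀ x → host? (lookup t x) ≡ true → ColouredA x × Crowded x
    host-crowded x = go (roles x)
      where
      go : ∀ {τ} → HasRole x τ → host? τ ≡ true → ColouredA x × Crowded x
      go (as-host ca c) _ = ca , c

    hostOfGuest : ∀ x → guest? (lookup t x) ≡ true → Fin n
    hostOfGuest x p = proj₁ (guest-nearA x p)

    hostOfGuest-sameBlock : ∀ x p → lookup v (hostOfGuest x p) ≡ lookup v x
    hostOfGuest-sameBlock x p = proj₁ (proj₂ (guest-nearA x p))

    hostOfGuest-colourA : ∀ x p → lookup col (hostOfGuest x p) ≡ a
    hostOfGuest-colourA x p = proj₂ (proj₂ (guest-nearA x p))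

    hostOfGuest-unique : ∀ x p z → lookup v z ≡ lookup v x → lookup col z ≡ a → hostOfGuest x p ≡ z
    hostOfGuest-unique x p z same ca = avoids _ _ (trans (hostOfGuest-sameBlock x p) (sym same)) (hostOfGuest-colourA x p) ca

    hostOfGuest-isHost : ∀ x p → host? (lookup t (hostOfGuest x p)) ≡ true
    hostOfGuest-isHost x p = hasRole-host _ (hostOfGuest-colourA x p)
      (x , x≢host , sym (hostOfGuest-sameBlock x p))
      where
      x≢host : x ≢ hostOfGuest x p
      x≢host e = otherColour-≢a x (guestHasOtherColour (lookup t x) p) (sym (trans (cong (lookup col) e) (hostOfGuest-colourA x p)))
        where
        guestHasOtherColour : ∀ τ → guest? τ ≡ true → otherColour? τ ≡ true
        guestHasOtherColour guest _ = refl

    otherColourIndex : Fin (count otherColour? t) → Fin d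
    otherColourIndex k = punchOut (otherColour-≢a (OtherColours.select t k) (OtherColours.select-satisfies t k))

    otherColours : Vec (Fin d) (count otherColour? t)
    otherColours = tabulate otherColourIndex

    hostIndex : Fin (count guest? t) → Fin (count host? t)
    hostIndex k = Hosts.rank t (hostOfGuest x px) (hostOfGuest-isHost x px)
      where
      x : Fin n
      x = Guests.select t k
      px : guest? (lookup t x) ≡ true
      px = Guests.select-satisfies t k

    hostOf : Vec (Fin (count host? t)) (count guest? t)
    hostOf = tabulate hostIndex

    -- A host z has a block-mate w, which cannot have colour a, so w is a guest of z.
    hostOf-onto : IsOnto hostOf
    hostOf-onto l = Guests.rank t w pw , (begin
      lookup hostOf (Guests.rank t w pw)      ≡⟨ lookup∘tabulate hostIndex _ ⟩
      hostIndex (Guests.rank t w pw)          ≡⟨ Hosts.rank-cong t _ (Hosts.select-satisfies t l) (hostOfGuest-unique _ _ z z-same-w zca) ⟩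
      Hosts.rank t z _                        ≡⟨ Hosts.rank-select t l _ ⟩
      l                                       ∎)
      where
      z : Fin n
      z = Hosts.select t l
      zca : lookup col z ≡ a
      zca = proj₁ (host-crowded z (Hosts.select-satisfies t l))
      companion : Crowded z
      companion = proj₂ (host-crowded z (Hosts.select-satisfies t l))
      w : Fin n
      w = proj₁ companion
      w≢z : w ≢ z
      w≢z = proj₁ (proj₂ companion)
      w-same-z : lookup v w ≡ lookup v z
      w-same-z = proj₂ (proj₂ companion)
      pw : guest? (lookup t w) ≡ true
      pw = hasRole-guest w (λ ca → w≢z (avoids w z w-same-z ca zca)) (z , sym w-same-z , zca)
      z-same-w : lookup v z ≡ lookup v (Guests.select t (Guests.rank t w pw))
      z-same-w = trans (sym w-same-z) (cong (lookup v) (sym (Guests.select-rank t w pw)))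

    outsiders : Partition (count outsider? t)
    outsiders = KeyRGS.partitionOf _≟_ (lookup v ∘ Outsiders.select t)

    encoding : Decomposition d n
    encoding = t , otherColours , (hostOf , fromWitness hostOf-onto) , outsiders

  roleVector : Vec Role n
  roleVector = tabulate (proj₁ ∘ role)

  roleVector-correct : ∀ x → HasRole x (lookup roleVector x)
  roleVector-correct x = subst (HasRole x) (sym (lookup∘tabulate (proj₁ ∘ role) x)) (proj₂ (role x))

  encode : Decomposition d n
  encode = Given.encoding roleVector roleVector-correct

module DecodeEncode {d} (a : Fin (suc d)) {n} (v : Vec (Fin n) n) (col : Vec (Fin (suc d)) n)
                    (avoids : AtMostOneAPerBlock a v col)
                    (t : Vec Role n) (roles : ∀ x → Encode.HasRole a v col avoids x (lookup t x)) where
  open Encode a v col avoids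
  open Given t roles
  open ≡-Reasoning
  open Decode a t otherColours hostOf (proj₂ outsiders)
    using (key; colour; view; at-loner; at-host; at-guest; at-outsider; decoded; key-host; key-guest; key-outsider; sameBlock⇒≡; ≡⇒sameBlock)
    renaming (partition to partition′)

  otherColour-correct : ∀ x p → punchIn a (lookup otherColours (OtherColours.rank t x p)) ≡ lookup col x
  otherColour-correct x p = trans (cong (punchIn a) (trans (lookup∘tabulate otherColourIndex _)
    (punchOut-cong′ a (cong (lookup col) (OtherColours.select-rank t x p))))) (punchIn-punchOut _)

  colour-correct : ∀ x → colour x ≡ lookup col x
  colour-correct x with view x
  ... | at-loner h _ c    with as-loner ca _ ← roleAt x h = trans c (sym ca)
  ... | at-host h _ c     with as-host ca _  ← roleAt x h = trans c (sym ca)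
  ... | at-guest h _ c    = trans c (otherColour-correct x (cong otherColour? h))
  ... | at-outsider h _ c = trans c (otherColour-correct x (cong otherColour? h))

  private
    g : RGS (count outsider? t) (proj₁ outsiders)
    g = proj₂ outsiders

    outsider-blocks : ∀ i j → block g i ≡ block g j → lookup v (Outsiders.select t i) ≡ lookup v (Outsiders.select t j)
    outsider-blocks i j = Equivalence.to (KeyRGS.partitionOf-fibres _≟_ (lookup v ∘ Outsiders.select t) i j)

    outsider-blocks⁻¹ : ∀ i j → lookup v (Outsiders.select t i) ≡ lookup v (Outsiders.select t j) → block g i ≡ block g j
    outsider-blocks⁻¹ i j = Equivalence.from (KeyRGS.partitionOf-fibres _≟_ (lookup v ∘ Outsiders.select t) i j)

  representative : Decode.Key a t otherColours hostOf g → Fin n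
  representative (inj₁ x)        = x
  representative (inj₂ (inj₁ l)) = Hosts.select t l
  representative (inj₂ (inj₂ l)) = Outsiders.select t (proj₁ (block-onto g l))

  representative-sameBlock : ∀ x → lookup v (representative (key x)) ≡ lookup v x
  representative-sameBlock x with view x
  ... | at-loner h k _    = cong (lookup v ∘ representative) k
  ... | at-host h k _     = trans (cong (lookup v ∘ representative) k) (cong (lookup v) (Hosts.select-rank t x _))
  ... | at-guest h k _    = begin
    lookup v (representative (key x))                              ≡⟨ cong (lookup v ∘ representative) k ⟩
    lookup v (Hosts.select t (lookup hostOf r))                    ≡⟨ cong (lookup v ∘ Hosts.select t) (lookup∘tabulate hostIndex r) ⟩
    lookup v (Hosts.select t (Hosts.rank t (hostOfGuest y py) _))  ≡⟨ cong (lookup v) (Hosts.select-rank t _ _) ⟩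
    lookup v (hostOfGuest y py)                                    ≡⟨ hostOfGuest-sameBlock y py ⟩
    lookup v y                                                     ≡⟨ cong (lookup v) (Guests.select-rank t x _) ⟩
    lookup v x                                                     ∎
    where
    r : Fin (count guest? t)
    r = Guests.rank t x (cong guest? h)
    y : Fin n
    y = Guests.select t r
    py : guest? (lookup t y) ≡ true
    py = Guests.select-satisfies t r
  ... | at-outsider h k _ = begin
    lookup v (representative (key x))                              ≡⟨ cong (lookup v ∘ representative) k ⟩
    lookup v (Outsiders.select t (proj₁ (block-onto g (block g r)))) ≡⟨ outsider-blocks _ r (proj₂ (block-onto g (block g r))) ⟩
    lookup v (Outsiders.select t r)                                ≡⟨ cong (lookup v) (Outsiders.select-rank t x _) ⟩
    lookup v x                                                     ∎
    where
    r : Fin (count outsider? t)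
    r = Outsiders.rank t x (cong outsider? h)

  key⇒sameBlock : ∀ i j → key i ≡ key j → lookup v i ≡ lookup v j
  key⇒sameBlock i j e = begin
    lookup v i                        ≡⟨ representative-sameBlock i ⟨
    lookup v (representative (key i)) ≡⟨ cong (lookup v ∘ representative) e ⟩
    lookup v (representative (key j)) ≡⟨ representative-sameBlock j ⟩
    lookup v j                        ∎

  key-hostOfGuest : ∀ x p → key (hostOfGuest x p) ≡ key x
  key-hostOfGuest x p = begin
    key (hostOfGuest x p)                                  ≡⟨ key-host _ (hostOfGuest-isHost x p) ⟩
    inj₂ (inj₁ (Hosts.rank t (hostOfGuest x p) _))         ≡⟨ cong (inj₂ ∘ inj₁) (Hosts.rank-cong t _ _ same-host) ⟩
    inj₂ (inj₁ (hostIndex r))                              ≡⟨ cong (inj₂ ∘ inj₁) (lookup∘tabulate hostIndex r) ⟨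
    inj₂ (inj₁ (lookup hostOf r))                          ≡⟨ key-guest x p ⟨
    key x                                                  ∎
    where
    r : Fin (count guest? t)
    r = Guests.rank t x p
    y : Fin n
    y = Guests.select t r
    same-host : hostOfGuest x p ≡ hostOfGuest y (Guests.select-satisfies t r)
    same-host = sym (hostOfGuest-unique y _ (hostOfGuest x p)
      (trans (hostOfGuest-sameBlock x p) (cong (lookup v) (sym (Guests.select-rank t x p)))) (hostOfGuest-colourA x p))

  guests-sameBlock⇒key : ∀ i j (pi : guest? (lookup t i) ≡ true) (pj : guest? (lookup t j) ≡ true) →
                         lookup v i ≡ lookup v j → key i ≡ key j
  guests-sameBlock⇒key i j pi pj same = begin
    key i                       ≡⟨ key-hostOfGuest i pi ⟨
    key (hostOfGuest i pi)      ≡⟨ cong key (hostOfGuest-unique i pi _ (trans (hostOfGuest-sameBlock j pj) (sym same)) (hostOfGuest-colourA j pj)) ⟩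
    key (hostOfGuest j pj)      ≡⟨ key-hostOfGuest j pj ⟩
    key j                       ∎

  outsiders-sameBlock⇒key : ∀ i j (pi : outsider? (lookup t i) ≡ true) (pj : outsider? (lookup t j) ≡ true) →
                            lookup v i ≡ lookup v j → key i ≡ key j
  outsiders-sameBlock⇒key i j pi pj same = begin
    key i                                          ≡⟨ key-outsider i pi ⟩
    inj₂ (inj₂ (block g (Outsiders.rank t i pi)))  ≡⟨ cong (inj₂ ∘ inj₂) (outsider-blocks⁻¹ _ _ (begin
      lookup v (Outsiders.select t (Outsiders.rank t i pi)) ≡⟨ cong (lookup v) (Outsiders.select-rank t i pi) ⟩
      lookup v i                                            ≡⟨ same ⟩
      lookup v j                                            ≡⟨ cong (lookup v) (Outsiders.select-rank t j pj) ⟨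
      lookup v (Outsiders.select t (Outsiders.rank t j pj)) ∎)) ⟩
    inj₂ (inj₂ (block g (Outsiders.rank t j pj)))  ≡⟨ key-outsider j pj ⟨
    key j                                          ∎

  sameBlock⇒key : ∀ i j → lookup v i ≡ lookup v j → key i ≡ key j
  sameBlock⇒key i j same with i ≟ j
  ... | yes refl = refl
  ... | no i≢j with view i | view j
  ... | at-loner h _ _ | _ with as-loner _ alone ← roleAt i h = ⊥-elim (alone (j , i≢j ∘ sym , sym same))
  ... | _ | at-loner h _ _ with as-loner _ alone ← roleAt j h = ⊥-elim (alone (i , i≢j , same))
  ... | at-host h _ _ | at-host h′ _ _ with as-host ca _ ← roleAt i h | as-host ca′ _ ← roleAt j h′ =
    ⊥-elim (i≢j (avoids i j same ca ca′))
  ... | at-host h _ _ | at-guest h′ _ _ with as-host ca _ ← roleAt i h =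
    trans (cong key (sym (hostOfGuest-unique j _ i same ca))) (key-hostOfGuest j (cong guest? h′))
  ... | at-guest h _ _ | at-host h′ _ _ with as-host ca _ ← roleAt j h′ =
    trans (sym (key-hostOfGuest i (cong guest? h))) (cong key (hostOfGuest-unique i _ j (sym same) ca))
  ... | at-guest h _ _ | at-guest h′ _ _ = guests-sameBlock⇒key i j (cong guest? h) (cong guest? h′) same
  ... | at-outsider h _ _ | at-outsider h′ _ _ = outsiders-sameBlock⇒key i j (cong outsider? h) (cong outsider? h′) same
  ... | at-host h _ _ | at-outsider h′ _ _ with as-host ca _ ← roleAt i h | as-outsider _ far ← roleAt j h′ =
    ⊥-elim (far (i , same , ca))
  ... | at-outsider h _ _ | at-host h′ _ _ with as-outsider _ far ← roleAt i h | as-host ca _ ← roleAt j h′ =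
    ⊥-elim (far (j , sym same , ca))
  ... | at-guest h _ _ | at-outsider h′ _ _ with as-guest _ (z , z-same , ca) ← roleAt i h | as-outsider _ far ← roleAt j h′ =
    ⊥-elim (far (z , trans z-same same , ca))
  ... | at-outsider h _ _ | at-guest h′ _ _ with as-outsider _ far ← roleAt i h | as-guest _ (z , z-same , ca) ← roleAt j h′ =
    ⊥-elim (far (z , trans z-same (sym same) , ca))

  decode-encode : (vp : True (isSetPartition? v)) {pf : True (¬? (eqContains11? a ((v , vp) , col)))} →
                  decoded ≡ (((v , vp) , col) , pf)
  decode-encode vp = Σ-True-≡ (λ x → ¬? (eqContains11? a x)) (cong₂ _,_
    (SetPartition-≡ partition′ (v , vp) (λ i j → key⇒sameBlock i j ∘ sameBlock⇒≡ i j)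
                                        (λ i j → ≡⇒sameBlock i j ∘ sameBlock⇒key i j))
    (≗-lookup⇒≡ λ x → trans (lookup∘tabulate colour x) (colour-correct x)))

module EncodeDecode {d} (a : Fin (suc d)) {n} (t : Vec Role n) (cs : Vec (Fin d) (count otherColour? t))
                    (hostOf : Vec (Fin (count host? t)) (count guest? t)) (onto : IsOnto hostOf)
                    {b} (g : RGS (count outsider? t) b)
                    (avoids : AtMostOneAPerBlock a (proj₁ (Decode.partition a t cs hostOf g)) (Decode.colours a t cs hostOf g)) where
  open Decode a t cs hostOf g
  open ≡-Reasoning
  open Encode a (proj₁ partition) colours avoids using (module Given; encode; roleVector; roleVector-correct; HasRole; HasRole-unique)

  module _ (roles : ∀ x → HasRole x (lookup t x)) where
    open Given t roles using (otherColours; otherColourIndex; hostIndex; hostOfGuest; hostOfGuest-unique; outsiders; encoding)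
      renaming (hostOf to hostOf′)

    otherColours-correct : otherColours ≡ cs
    otherColours-correct = ≗-lookup⇒≡ λ k → trans (lookup∘tabulate otherColourIndex k)
      (trans (punchOut-cong′ a (begin
        lookup colours (OtherColours.select t k)                             ≡⟨ colours-lookup _ ⟩
        colour (OtherColours.select t k)                                     ≡⟨ colour-otherColour _ (OtherColours.select-satisfies t k) ⟩
        punchIn a (lookup cs (OtherColours.rank t (OtherColours.select t k) _)) ≡⟨ cong (punchIn a ∘ lookup cs) (OtherColours.rank-select t k _) ⟩
        punchIn a (lookup cs k)                                              ∎))
      (punchOut-punchIn a))

    hostOf-correct : hostOf′ ≡ hostOf
    hostOf-correct = ≗-lookup⇒≡ λ k → begin
      lookup hostOf′ k                                         ≡⟨ lookup∘tabulate hostIndex k ⟩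
      hostIndex k                                              ≡⟨ Hosts.rank-cong t _ (Hosts.select-satisfies t (lookup hostOf k)) (the-host k) ⟩
      Hosts.rank t (Hosts.select t (lookup hostOf k)) _        ≡⟨ Hosts.rank-select t _ _ ⟩
      lookup hostOf k                                          ∎
      where
      the-host : ∀ k → hostOfGuest (Guests.select t k) (Guests.select-satisfies t k) ≡ Hosts.select t (lookup hostOf k)
      the-host k = hostOfGuest-unique y py h (≡⇒sameBlock h y (begin
          key h                                              ≡⟨ key-host h ph ⟩
          inj₂ (inj₁ (Hosts.rank t h ph))                    ≡⟨ cong (inj₂ ∘ inj₁) (Hosts.rank-select t _ ph) ⟩
          inj₂ (inj₁ (lookup hostOf k))                      ≡⟨ cong (inj₂ ∘ inj₁ ∘ lookup hostOf) (Guests.rank-select t k py) ⟨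
          inj₂ (inj₁ (lookup hostOf (Guests.rank t y py)))   ≡⟨ key-guest y py ⟨
          key y                                              ∎))
        (trans (colours-lookup h) (colour-host h ph))
        where
        y h : Fin n
        y = Guests.select t k
        h = Hosts.select t (lookup hostOf k)
        py : guest? (lookup t y) ≡ true
        py = Guests.select-satisfies t k
        ph : host? (lookup t h) ≡ true
        ph = Hosts.select-satisfies t (lookup hostOf k)

    outsiders-correct : outsiders ≡ (b , g)
    outsiders-correct = Partition-≡ outsiders (b , g)
      (λ k k′ e → inj₂-injective (inj₂-injective (trans (sym (key-outsider-select k))
        (trans (sameBlock⇒≡ _ _ (Equivalence.to (fibres k k′) e)) (key-outsider-select k′)))))
      (λ k k′ e → Equivalence.from (fibres k k′)
        (≡⇒sameBlock _ _ (trans (key-outsider-select k) (trans (cong (inj₂ ∘ inj₂) e) (sym (key-outsider-select k′))))))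
      where
      fibres : KeyRGS.BlocksAreFibres _≟_ (lookup (proj₁ partition) ∘ Outsiders.select t) outsiders
      fibres = KeyRGS.partitionOf-fibres _≟_ (lookup (proj₁ partition) ∘ Outsiders.select t)
      key-outsider-select : ∀ k → key (Outsiders.select t k) ≡ inj₂ (inj₂ (block g k))
      key-outsider-select k = trans (key-outsider _ (Outsiders.select-satisfies t k))
                                    (cong (inj₂ ∘ inj₂ ∘ block g) (Outsiders.rank-select t k _))

    encoding-correct : ∀ onto-pf → encoding ≡ (t , cs , (hostOf , onto-pf) , (b , g))
    encoding-correct onto-pf = cong (t ,_) (cong₂ _,_ otherColours-correct
      (cong₂ _,_ (Σ-True-≡ isOnto? hostOf-correct) outsiders-correct))

  roleVector≡t : roleVector ≡ t
  roleVector≡t = ≗-lookup⇒≡ λ x → HasRole-unique (roleVector-correct x) (decoded-roles onto x)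

  encode-decode : ∀ onto-pf → encode ≡ (t , cs , (hostOf , onto-pf) , (b , g))
  encode-decode onto-pf = go roleVector roleVector≡t roleVector-correct
    where
    go : ∀ t′ → t′ ≡ t → (t′-roles : ∀ x → HasRole x (lookup t′ x)) → Given.encoding t′ t′-roles ≡ (t , cs , (hostOf , onto-pf) , (b , g))
    go t′ refl t′-roles = encoding-correct t′-roles onto-pf

module _ {d n : ℕ} {a : Fin (suc d)} where

  atMostOneAPerBlock : (x : EqAvoiders n (suc d) a) → AtMostOneAPerBlock a (proj₁ (proj₁ (proj₁ x))) (proj₂ (proj₁ x))
  atMostOneAPerBlock (_ , avoids) i j same ci cj with i ≟ j
  ... | yes i≡j = i≡j
  ... | no i≢j  = ⊥-elim (toWitness avoids (i , j , i≢j , same , ci , cj))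

  EqAvoiders↔Decomposition : EqAvoiders n (suc d) a ↔ Decomposition d n
  EqAvoiders↔Decomposition = mk↔ₛ′ to from to∘from from∘to
    where
    to : EqAvoiders n (suc d) a → Decomposition d n
    to x@(((v , _) , col) , _) = Encode.encode a v col (atMostOneAPerBlock x)
    from : Decomposition d n → EqAvoiders n (suc d) a
    from (t , cs , (hostOf , _) , outsiders) = Decode.decoded a t cs hostOf (proj₂ outsiders)
    to∘from : ∀ y → to (from y) ≡ y
    to∘from (t , cs , (hostOf , onto) , (b , g)) =
      EncodeDecode.encode-decode a t cs hostOf (toWitness onto) g (atMostOneAPerBlock (from (t , cs , (hostOf , onto) , (b , g)))) onto
    from∘to : ∀ x → from (to x) ≡ x
    from∘to x@(((v , vp) , col) , _) =
      DecodeEncode.decode-encode a v col (atMostOneAPerBlock x) (Encode.roleVector a v col (atMostOneAPerBlock x))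
                                 (Encode.roleVector-correct a v col (atMostOneAPerBlock x)) vp

module MaybeMask {X : Set} where

  mask : ∀ {n} → Vec (Maybe X) n → Σ (Vec Bool n) (λ s → Vec X (falses s))
  mask []             = [] , []
  mask (nothing ∷ xs) = true ∷ proj₁ (mask xs) , proj₂ (mask xs)
  mask (just x ∷ xs)  = false ∷ proj₁ (mask xs) , x ∷ proj₂ (mask xs)

  unmask : ∀ {n} → Σ (Vec Bool n) (λ s → Vec X (falses s)) → Vec (Maybe X) n
  unmask ([] , [])           = []
  unmask (true ∷ s , ys)     = nothing ∷ unmask (s , ys)
  unmask (false ∷ s , y ∷ ys) = just y ∷ unmask (s , ys)

  Vec-Maybe↔ : ∀ {n} → Vec (Maybe X) n ↔ Σ (Vec Bool n) (λ s → Vec X (falses s))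
  Vec-Maybe↔ = mk↔ₛ′ mask unmask mask∘unmask unmask∘mask
    where
    mask∘unmask : ∀ {n} (y : Σ (Vec Bool n) (λ s → Vec X (falses s))) → mask (unmask y) ≡ y
    mask∘unmask ([] , [])            = refl
    mask∘unmask (true ∷ s , ys)      rewrite mask∘unmask (s , ys) = refl
    mask∘unmask (false ∷ s , y ∷ ys) rewrite mask∘unmask (s , ys) = refl
    unmask∘mask : ∀ {n} (xs : Vec (Maybe X) n) → unmask (mask xs) ≡ xs
    unmask∘mask []             = refl
    unmask∘mask (nothing ∷ xs) = cong (nothing ∷_) (unmask∘mask xs)
    unmask∘mask (just x ∷ xs)  = cong (just x ∷_) (unmask∘mask xs)

  count-justs : ∀ (p : Maybe X → Bool) → p nothing ≡ false →
                ∀ {n} (xs : Vec (Maybe X) n) → count p xs ≡ count (p ∘ just) (proj₂ (mask xs))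
  count-justs p p₀ []             = refl
  count-justs p p₀ (nothing ∷ xs) rewrite p₀ = count-justs p p₀ xs
  count-justs p p₀ (just x ∷ xs)  = cong (λ c → if p (just x) then suc c else c) (count-justs p p₀ xs)

  count-nothings : ∀ (p : Maybe X → Bool) → p nothing ≡ true → (∀ x → p (just x) ≡ false) →
                   ∀ {n} (xs : Vec (Maybe X) n) → count p xs ≡ trues (proj₁ (mask xs))
  count-nothings p p₀ pₓ []             = refl
  count-nothings p p₀ pₓ (nothing ∷ xs) rewrite p₀ = cong suc (count-nothings p p₀ pₓ xs)
  count-nothings p p₀ pₓ (just x ∷ xs)  rewrite pₓ x = count-nothings p p₀ pₓ xs

  count-all-justs : ∀ (p : Maybe X → Bool) → p nothing ≡ false → (∀ x → p (just x) ≡ true) →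
                    ∀ {n} (xs : Vec (Maybe X) n) → count p xs ≡ falses (proj₁ (mask xs))
  count-all-justs p p₀ pₓ []             = refl
  count-all-justs p p₀ pₓ (nothing ∷ xs) rewrite p₀ = count-all-justs p p₀ pₓ xs
  count-all-justs p p₀ pₓ (just x ∷ xs)  rewrite pₓ x = cong suc (count-all-justs p p₀ pₓ xs)

RoleMasks : ℕ → Set
RoleMasks n = Σ (Vec Bool n) λ s₁ → Σ (Vec Bool (falses s₁)) λ s₂ → Vec Bool (falses s₂)

module RoleMask = MaybeMask {Maybe Bool}
module HostMask = MaybeMask {Bool}

Vec-Role↔RoleMasks : ∀ {n} → Vec Role n ↔ RoleMasks n
Vec-Role↔RoleMasks = congˡ HostMask.Vec-Maybe↔ ↔-∘ RoleMask.Vec-Maybe↔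

MaskedData : ℕ → ∀ {n} → RoleMasks n → Set
MaskedData d (s₁ , s₂ , s₃) = Vec (Fin d) (falses s₂) × Onto (trues s₃) (trues s₂) × Partition (falses s₃)

Decomposition↔masks : ∀ d n → Decomposition d n ↔ Σ (RoleMasks n) (MaskedData d)
Decomposition↔masks d n = Σ-cong Vec-Role↔RoleMasks (λ {t} → K-reflexive (same-sizes t))
  where
  same-sizes : ∀ (t : Vec Role n) →
    (Vec (Fin d) (count otherColour? t) × Onto (count guest? t) (count host? t) × Partition (count outsider? t))
    ≡ MaskedData d (Inverse.to Vec-Role↔RoleMasks t)
  same-sizes t rewrite RoleMask.count-justs otherColour? refl t
                     | RoleMask.count-justs guest? refl t
                     | RoleMask.count-justs host? refl t
                     | RoleMask.count-justs outsider? refl t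
                     | HostMask.count-all-justs (otherColour? ∘ just) refl (λ _ → refl) (proj₂ (RoleMask.mask t))
                     | HostMask.count-justs (guest? ∘ just) refl (proj₂ (RoleMask.mask t))
                     | HostMask.count-nothings (host? ∘ just) refl (λ _ → refl) (proj₂ (RoleMask.mask t))
                     | HostMask.count-justs (outsider? ∘ just) refl (proj₂ (RoleMask.mask t)) = refl

module _ (d : ℕ) where

  open ↔-Reasoning

  guestsAndOutsiders : ℕ → ℕ → ℕ
  guestsAndOutsiders j q = ∑ (suc q) λ p → (q C p) * (d ^ q * (S p j * j ! * B (q ∸ p)))

  nonLoners : ℕ → ℕ
  nonLoners m = ∑ (suc m) λ j → (m C j) * guestsAndOutsiders j (m ∸ j)

  decompositions : ℕ → ℕ
  decompositions n = ∑ (suc n) λ i → (n C i) * nonLoners (n ∸ i)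

  guestsAndOutsiders↔ : ∀ j q → Σ (Vec Bool q) (λ s → Vec (Fin d) q × Onto (trues s) j × Partition (falses s))
                                ↔ Fin (guestsAndOutsiders j q)
  guestsAndOutsiders↔ j q = Σ-Vec-Bool↔∑C q (λ p r → Vec (Fin d) q × Onto p j × Partition r) _ λ p →
    ↔-sym *↔× ↔-∘ (Vec↔^ d q ×-cong (↔-sym *↔× ↔-∘ (Onto↔S*! p j ×-cong Partition↔B (q ∸ p))))

  NonLonerData : ℕ → Set
  NonLonerData m = Σ (Vec Bool m) λ s₂ → Σ (Vec Bool (falses s₂)) λ s₃ →
                   Vec (Fin d) (falses s₂) × Onto (trues s₃) (trues s₂) × Partition (falses s₃)

  nonLoners↔ : ∀ m → NonLonerData m ↔ Fin (nonLoners m)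
  nonLoners↔ m = Σ-Vec-Bool↔∑C m (λ j q → Σ (Vec Bool q) λ s → Vec (Fin d) q × Onto (trues s) j × Partition (falses s))
                               (λ j → guestsAndOutsiders j (m ∸ j)) λ j → guestsAndOutsiders↔ j (m ∸ j)

  Decomposition↔decompositions : ∀ n → Decomposition d n ↔ Fin (decompositions n)
  Decomposition↔decompositions n = begin
    Decomposition d n                 ↔⟨ Decomposition↔masks d n ⟩
    Σ (RoleMasks n) (MaskedData d)    ↔⟨ mk↔ₛ′ (λ ((s₁ , s₂ , s₃) , x) → s₁ , s₂ , s₃ , x) (λ (s₁ , s₂ , s₃ , x) → (s₁ , s₂ , s₃) , x)
                                                (λ _ → refl) (λ _ → refl) ⟩
    Σ (Vec Bool n) (λ s₁ → NonLonerData (falses s₁)) ↔⟨ Σ-Vec-Bool↔∑C n (λ _ → NonLonerData) (nonLoners ∘ (n ∸_)) (λ i → nonLoners↔ (n ∸ i)) ⟩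
    Fin (decompositions n)            ∎

S-< : ∀ p j → p < j → S p j ≡ 0
S-< zero    (suc j) _         = refl
S-< (suc p) (suc j) (s≤s p<j) rewrite S-< p (suc j) (m≤n⇒m≤1+n p<j) | S-< p j p<j = trans (+-identityʳ (j * 0)) (*-zeroʳ j)

n!≡nCk*k!*[n∸k]! : ∀ n k → k ≤ n → n ! ≡ (n C k) * (k ! * (n ∸ k) !)
n!≡nCk*k!*[n∸k]! n k k≤n = sym (trans (cong (_* (k ! * (n ∸ k) !)) (nCk≡n!/k![n-k]! k≤n))
  (m/n*n≡m {{m*n≢0 (k !) ((n ∸ k) !) {{k !≢0}} {{(n ∸ k) !≢0}}}} (k![n∸k]!∣n! k≤n)))

multinomial≡C*C : ∀ n i j → i + j ≤ n → multinomial n i j ≡ (n C i) * ((n ∸ i) C j)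
multinomial≡C*C n i j i+j≤n = trans (cong (λ m → (m / (i ! * j ! * (n ∸ i ∸ j) !)) {{nonZero}}) n!≡)
                                    (m*n/n≡m _ _ {{nonZero}})
  where
  nonZero : NonZero (i ! * j ! * (n ∸ i ∸ j) !)
  nonZero = m*n≢0 (i ! * j !) ((n ∸ i ∸ j) !) {{m*n≢0 (i !) (j !) {{i !≢0}} {{j !≢0}}}} {{(n ∸ i ∸ j) !≢0}}
  j≤n∸i : j ≤ n ∸ i
  j≤n∸i = ≤-trans (≤-reflexive (sym (m+n∸m≡n i j))) (∸-monoˡ-≤ i i+j≤n)
  regroup : ∀ a b x y z → a * (x * (b * (y * z))) ≡ a * b * (x * y * z)
  regroup = solve-∀
  n!≡ : n ! ≡ (n C i) * ((n ∸ i) C j) * (i ! * j ! * (n ∸ i ∸ j) !)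
  n!≡ = trans (n!≡nCk*k!*[n∸k]! n i (≤-trans (m≤m+n i j) i+j≤n))
       (trans (cong (λ m → (n C i) * (i ! * m)) (n!≡nCk*k!*[n∸k]! (n ∸ i) j j≤n∸i))
              (regroup (n C i) ((n ∸ i) C j) (i !) (j !) ((n ∸ i ∸ j) !)))

n∸i∸j<j : ∀ n i j → i ≤ n → ¬ (i + 2 * j ≤ n) → n ∸ i ∸ j < j
n∸i∸j<j n i j i≤n i+2j≰n = ∸-<-half (n ∸ i) j (+-cancelˡ-< i (n ∸ i) (j + j) n<i+2j)
  where
  n<i+2j : i + (n ∸ i) < i + (j + j)
  n<i+2j = subst₂ _<_ (sym (m+[n∸m]≡n i≤n)) (cong (λ x → i + (j + x)) (+-identityʳ j)) (≰⇒> i+2j≰n)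
  ∸-<-half : ∀ k j → k < j + j → k ∸ j < j
  ∸-<-half k (suc j) (s≤s k≤j+j) = s≤s (subst (k ∸ suc j ≤_) (m+n∸n≡m j (suc j)) (∸-monoˡ-≤ (suc j) k≤j+j))

module _ (d : ℕ) where

  open ≡-Reasoning

  private
    guestsAndOutsidersTerm : ℕ → ℕ → ℕ → ℕ
    guestsAndOutsidersTerm q j p = (q C p) * (d ^ q * (S p j * j ! * B (q ∸ p)))

    term-< : ∀ q j p → p < j → guestsAndOutsidersTerm q j p ≡ 0
    term-< q j p p<j rewrite S-< p j p<j = trans (cong ((q C p) *_) (*-zeroʳ (d ^ q))) (*-zeroʳ (q C p))

  sumFromTo≡guestsAndOutsiders : ∀ q j →
    sumFromTo j q (λ p → (q C p) * S p j * j ! * B (q ∸ p) * (suc d ∸ 1) ^ q) ≡ guestsAndOutsiders d j q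
  sumFromTo≡guestsAndOutsiders q j = begin
    sumFromTo j q summand                                     ≡⟨ sumFromTo≡∑ j q summand ⟩
    ∑ (suc q ∸ j) (summand ∘ (j +_))                          ≡⟨ ∑-cong (suc q ∸ j) (λ x _ → let p = j + x in reorder (q C p) (S p j) (j !) (B (q ∸ p)) (d ^ q)) ⟩
    ∑ (suc q ∸ j) (guestsAndOutsidersTerm q j ∘ (j +_))       ≡⟨ ∑-dropInitialZeros j (suc q) (guestsAndOutsidersTerm q j) (term-< q j) ⟨
    guestsAndOutsiders d j q                                  ∎
    where
    summand : ℕ → ℕ
    summand p = (q C p) * S p j * j ! * B (q ∸ p) * d ^ q
    reorder : ∀ a s f b e → a * s * f * b * e ≡ a * (e * (s * f * b))
    reorder = solve-∀

  -- Terms with i + 2j > n are 0 in rhs; here they vanish because either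
  -- j > n - i, or every Stirling factor S(p, j) has p ≤ n - i - j < j.
  summand≡ : ∀ n i j → i ≤ n →
    (if ⌊ i + 2 * j ℕ.≤? n ⌋ then inner n (suc d) i j else 0) ≡ (n C i) * (((n ∸ i) C j) * guestsAndOutsiders d j (n ∸ i ∸ j))
  summand≡ n i j i≤n with i + 2 * j ℕ.≤? n
  ... | yes i+2j≤n = trans (cong₂ _*_ (multinomial≡C*C n i j i+j≤n) (sumFromTo≡guestsAndOutsiders (n ∸ i ∸ j) j))
                           (*-assoc (n C i) _ _)
    where
    i+j≤n : i + j ≤ n
    i+j≤n = ≤-trans (+-monoʳ-≤ i (m≤m+n j (j + 0))) i+2j≤n
  ... | no i+2j≰n = sym (trans (cong ((n C i) *_) vanishes) (*-zeroʳ (n C i)))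
    where
    vanishes : ((n ∸ i) C j) * guestsAndOutsiders d j (n ∸ i ∸ j) ≡ 0
    vanishes with j ℕ.≤? n ∸ i
    ... | no j≰n∸i rewrite k>n⇒nCk≡0 (≰⇒> j≰n∸i) = refl
    ... | yes _ = trans (cong (((n ∸ i) C j) *_) (∑-zero (suc (n ∸ i ∸ j)) λ p p≤n∸i∸j →
                    term-< (n ∸ i ∸ j) j p (≤-<-trans (≤-pred p≤n∸i∸j) (n∸i∸j<j n i j i≤n i+2j≰n))))
                  (*-zeroʳ ((n ∸ i) C j))

  row≡ : ∀ n i → i ≤ n →
    sumFromTo 0 n (λ j → if ⌊ i + 2 * j ℕ.≤? n ⌋ then inner n (suc d) i j else 0) ≡ (n C i) * nonLoners d (n ∸ i)
  row≡ n i i≤n = begin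
    sumFromTo 0 n summand                                 ≡⟨ sumFromTo≡∑ 0 n summand ⟩
    ∑ (suc n) summand                                     ≡⟨ ∑-cong (suc n) (λ j _ → summand≡ n i j i≤n) ⟩
    ∑ (suc n) (λ j → (n C i) * nonLonerTerm j)            ≡⟨ ∑-*-distribˡ (suc n) (n C i) nonLonerTerm ⟩
    (n C i) * ∑ (suc n) nonLonerTerm                      ≡⟨ cong ((n C i) *_) (∑-dropFinalZeros (suc (n ∸ i)) (suc n) nonLonerTerm
                                                               (s≤s (m∸n≤m n i)) λ j n∸i<j _ → cong (_* guestsAndOutsiders d j (n ∸ i ∸ j)) (k>n⇒nCk≡0 n∸i<j)) ⟩
    (n C i) * nonLoners d (n ∸ i)                         ∎
    where
    summand : ℕ → ℕ
    summand j = if ⌊ i + 2 * j ℕ.≤? n ⌋ then inner n (suc d) i j else 0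
    nonLonerTerm : ℕ → ℕ
    nonLonerTerm j = ((n ∸ i) C j) * guestsAndOutsiders d j (n ∸ i ∸ j)

  rhs≡decompositions : ∀ n → rhs n (suc d) ≡ decompositions d n
  rhs≡decompositions n = trans (sumFromTo≡∑ 0 n _) (∑-cong (suc n) λ i i<1+n → row≡ n i (≤-pred i<1+n))

-- Both size hypotheses are superfluous: c ≥ 1 follows from a : Fin c, and the
-- identity also holds for n = 0.
theorem2p1 : (c n : ℕ) → 1 ≤ c → 1 ≤ n → (a : Fin c) →
    Fin (rhs n c) ↔ EqAvoiders n c a
theorem2p1 (suc d) n _ _ a = begin
  Fin (rhs n (suc d))        ≡⟨ cong Fin (rhs≡decompositions d n) ⟩
  Fin (decompositions d n)   ↔⟨ Decomposition↔decompositions d n ⟨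
  Decomposition d n          ↔⟨ EqAvoiders↔Decomposition ⟨
  EqAvoiders n (suc d) a     ∎
  where open ↔-Reasoning
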